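{- For all $n\ge2$, the number of idempotents of the Jones monoid $\mathscr J_n$ of rank $n-2$ is $3n-5$; that is, $e_{n;\cdot,n-2}=3n-5$.
   Context: Upper vertices $[n]=\{1,\dots,n\}$, lower vertices $[n]'$. The Jones monoid $\mathscr J_n$ consists of planar partitions of $[n]\cup[n]'$ into 2-element blocks (planar: placing $i$ at $(i,1)$, $i'$ at $(i,0)$, blocks can be drawn as disjoint curves in $[1,n]\times[0,1]$), with product given by identifying lower vertex $i'$ of the first factor with upper vertex $i$ of the second, taking connected components, restricting to the outer rows and discarding components entirely in the middle. The rank is the number of blocks meeting both rows. $e_{n;\cdot,p}$ denotes the number of idempotents of $\mathscr J_n$ of rank $p$ (in the paper, the sum over $c$ of the number $e_{n;c,p}$ of idempotents whose interface graph has $c$ cycles and $p$ paths; for idempotents the number of paths equals the rank). -}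

module Defs where

open import Data.Nat using (ℕ; _+_; _*_; _∸_; _<_; _≤?_)
open import Data.Fin using (Fin; toℕ; splitAt; _↑ˡ_)
open import Data.Sum using (_⊎_; inj₁; inj₂)
open import Data.Product using (_×_; ∃; _,_)
open import Data.Vec using (Vec; lookup)
open import Data.List using (List; length; filter; allFin)
open import Data.Empty using (⊥)
open import Relation.Nullary using (¬_)
open import Relation.Binary.PropositionalEquality using (_≡_)
open import Relation.Binary.Construct.Closure.ReflexiveTransitive using (Star)
open import Function.Bundles using (_⇔_)

-- Vertex set [n] ∪ [n]' encoded as Fin (n + n):
--   index k (k < n)      is the upper vertex k+1,
--   index n + k (k < n)  is the lower vertex (k+1)'.
Pt : ℕ → Set
Pt n = Fin (n + n)

-- A candidate diagram: the map sending each vertex to its block-partner.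
Diagram : ℕ → Set
Diagram n = Vec (Pt n) (n + n)

partner : ∀ {n} → Diagram n → Pt n → Pt n
partner {n} d a = lookup {n = n + n} d a

-- Position along the boundary of the rectangle (counter-clockwise reading):
-- upper vertices 1..n, then lower vertices n', ..., 1'.
pos : ∀ {n} → Pt n → ℕ
pos {n} a with splitAt n a
... | inj₁ i = toℕ i
... | inj₂ k = (n + n ∸ 1) ∸ toℕ k

-- d encodes a partition of [n] ∪ [n]' into 2-element blocks
IsPerfectMatching : ∀ {n} → Diagram n → Set
IsPerfectMatching {n} d = ∀ (a : Pt n) → (partner {n} d (partner {n} d a) ≡ a) × ¬ (partner {n} d a ≡ a)

-- planarity: no two blocks cross (with respect to the boundary order)
IsPlanar : ∀ {n} → Diagram n → Set
IsPlanar {n} d = ∀ (a c : Pt n) →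
  pos {n} a < pos {n} c → pos {n} c < pos {n} (partner {n} d a) → pos {n} (partner {n} d a) < pos {n} (partner {n} d c) → ⊥

-- elements of the Jones monoid J_n (each planar 2-block partition has exactly one encoding)
IsJones : ∀ {n} → Diagram n → Set
IsJones {n} d = IsPerfectMatching {n} d × IsPlanar {n} d

-- vertices of the glued graph used to compute the product d · e
data GV (n : ℕ) : Set where
  top mid bot : Fin n → GV n

emb₁ : ∀ {n} → Pt n → GV n
emb₁ {n} a with splitAt n a
... | inj₁ i = top i
... | inj₂ k = mid k

emb₂ : ∀ {n} → Pt n → GV n
emb₂ {n} a with splitAt n a
... | inj₁ i = mid i
... | inj₂ k = bot k

outer : ∀ {n} → Pt n → GV n
outer {n} a with splitAt n a
... | inj₁ i = top i
... | inj₂ k = bot k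

Edge : ∀ {n} → Diagram n → Diagram n → GV n → GV n → Set
Edge {n} d e x y =
  (∃ λ (a : Pt n) → (emb₁ {n} a ≡ x) × (emb₁ {n} (partner {n} d a) ≡ y)) ⊎
  (∃ λ (a : Pt n) → (emb₂ {n} a ≡ x) × (emb₂ {n} (partner {n} e a) ≡ y))

Connected : ∀ {n} → Diagram n → Diagram n → GV n → GV n → Set
Connected {n} d e = Star (Edge {n} d e)

-- "d · e = f": the blocks of the product (connected components restricted to
-- the outer rows) coincide with the blocks of f
ProductIs : ∀ {n} → Diagram n → Diagram n → Diagram n → Set
ProductIs {n} d e f = ∀ (a b : Pt n) → Connected d e (outer {n} a) (outer {n} b) ⇔ ((a ≡ b) ⊎ (partner {n} f a ≡ b))

IsIdempotent : ∀ {n} → Diagram n → Set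
IsIdempotent {n} d = ProductIs {n} d d d

-- rank: number of blocks meeting both rows = number of upper vertices whose partner is lower
rank : ∀ {n} → Diagram n → ℕ
rank {n} d = length (filter (λ i → n ≤? toℕ (partner {n} d (i ↑ˡ n))) (allFin n))

IsIdempotentOfRank : (n p : ℕ) → Diagram n → Set
IsIdempotentOfRank n p d = IsJones {n} d × IsIdempotent {n} d × (rank {n} d ≡ p)

module Submission where

-- A Jones diagram of rank m has one cup {i, i+1} on the upper row and one
-- cap {j', (j+1)'} on the lower row, and planarity joins the other m upper
-- vertices in order to the other m lower ones: the Jones diagrams of rank m
-- are exactly the standard diagrams D(i,j), 0 ≤ i, j ≤ m.  Gluing D(i,j) to
-- itself puts the cap j and the cup i on the middle row.  If |i - j| ≤ 1
-- the product is D(i,j) (a labelling constant along the edges of the glued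
-- graph, plus explicit paths); if |i - j| ≥ 2 two outer vertices of
-- different blocks are joined through the middle.  Hence the idempotents
-- are D(i,i), D(i,i+1), D(j+1,j), and there are (m+1) + m + m = 3n - 5.

open import Defs
open import Data.Nat using (ℕ; zero; suc; _+_; _*_; _∸_; _≤_; _<_; _⊓_; s≤s; _≤?_; _<?_; _≟_)
open import Data.Nat.Properties
open import Data.Nat.Tactic.RingSolver using (solve-∀)
open import Data.Empty using (⊥; ⊥-elim)
open import Data.Sum using (_⊎_; inj₁; inj₂; swap)
open import Data.Product using (Σ; _×_; _,_; proj₁; proj₂)
open import Data.Fin using (Fin; toℕ; splitAt; _↑ˡ_) renaming (zero to fzero; suc to fsuc)
open import Data.Fin.Properties using (toℕ-injective; toℕ-↑ˡ; toℕ-↑ʳ; splitAt⁻¹-↑ˡ; splitAt⁻¹-↑ʳ; toℕ<n)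
open import Data.Vec using (tabulate)
open import Data.Vec.Properties using (lookup∘tabulate; tabulate∘lookup; tabulate-cong)
open import Data.List using (List; []; _∷_; _++_; length; filter; allFin; applyUpTo)
open import Data.List.Properties using (length-tabulate; length-applyUpTo; length-++)
open import Data.List.Relation.Unary.Unique.Propositional using (Unique)
open import Data.List.Relation.Unary.Unique.Propositional.Properties using (filter⁺; allFin⁺; applyUpTo⁺₁; ++⁺)
open import Data.List.Relation.Unary.AllPairs using ([]; _∷_)
open import Data.List.Relation.Unary.All using (_∷_)
open import Data.List.Relation.Unary.Any using (here; there)
open import Data.List.Membership.Propositional using (_∈_)
open import Data.List.Membership.Propositional.Properties using (∈-filter⁺; ∈-filter⁻; ∈-allFin; ∈-applyUpTo⁺; ∈-applyUpTo⁻; ∈-++⁺ˡ; ∈-++⁺ʳ; ∈-++⁻)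
open import Relation.Nullary using (¬_; yes; no; Dec; ¬?)
open import Relation.Unary using (Decidable)
open import Relation.Binary using (tri<; tri≈; tri>)
open import Relation.Binary.PropositionalEquality
open import Relation.Binary.Construct.Closure.ReflexiveTransitive using (ε; _◅_; reverse)
open import Function.Base using (_∘_)
open import Function.Bundles using (_⇔_; mk⇔; Equivalence)

-- The through strands
-- of D(i,j) send the k-th upper vertex outside the cup to the k-th lower
-- vertex outside the cap, i.e. x ↦ openGap j (closeGap i x).

openGap : ℕ → ℕ → ℕ
openGap g y with y <? g
... | yes _ = y
... | no _ = suc (suc y)

closeGap : ℕ → ℕ → ℕ
closeGap g u with u <? g
... | yes _ = u
... | no _ = u ∸ 2

OffGap : ℕ → ℕ → Set
OffGap g u = (u ≢ g) × (u ≢ suc g)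

openGap-below : ∀ {g y} → y < g → openGap g y ≡ y
openGap-below {g} {y} p with y <? g
... | yes _ = refl
... | no q = ⊥-elim (q p)

openGap-above : ∀ {g y} → g ≤ y → openGap g y ≡ suc (suc y)
openGap-above {g} {y} p with y <? g
... | yes q = ⊥-elim (<⇒≱ q p)
... | no _ = refl

closeGap-below : ∀ {g u} → u < g → closeGap g u ≡ u
closeGap-below {g} {u} p with u <? g
... | yes _ = refl
... | no q = ⊥-elim (q p)

closeGap-above : ∀ {g u} → g ≤ u → closeGap g u ≡ u ∸ 2
closeGap-above {g} {u} p with u <? g
... | yes q = ⊥-elim (<⇒≱ q p)
... | no _ = refl

offGap-above : ∀ {g u} → g ≤ u → OffGap g u → suc (suc g) ≤ u
offGap-above p (u≢g , u≢g+1) with m≤n⇒m<n∨m≡n p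
... | inj₂ e = ⊥-elim (u≢g (sym e))
... | inj₁ q with m≤n⇒m<n∨m≡n q
... | inj₂ e = ⊥-elim (u≢g+1 (sym e))
... | inj₁ r = r

above-gap-∸2 : ∀ {g u} → suc (suc g) ≤ u → suc (suc (u ∸ 2)) ≡ u
above-gap-∸2 (s≤s (s≤s _)) = refl

above-gap-≤∸2 : ∀ {g u} → suc (suc g) ≤ u → g ≤ u ∸ 2
above-gap-≤∸2 {g} p = ≤-pred (≤-pred (subst (suc (suc g) ≤_) (sym (above-gap-∸2 p)) p))

closeGap∘openGap : ∀ g y → closeGap g (openGap g y) ≡ y
closeGap∘openGap g y with y <? g
... | yes p = closeGap-below p
... | no p = closeGap-above (≤-trans (≮⇒≥ p) (≤-trans (n≤1+n y) (n≤1+n (suc y))))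

openGap∘closeGap : ∀ g u → OffGap g u → openGap g (closeGap g u) ≡ u
openGap∘closeGap g u off with u <? g
... | yes p = openGap-below p
... | no p = let above = offGap-above (≮⇒≥ p) off in
  trans (openGap-above (above-gap-≤∸2 above)) (above-gap-∸2 above)

openGap-offGap : ∀ g y → OffGap g (openGap g y)
openGap-offGap g y with y <? g
... | yes p = (λ e → <⇒≢ p e) , (λ e → <⇒≢ (≤-trans p (n≤1+n g)) e)
... | no p = (λ e → ≤⇒≯ (≮⇒≥ p) (≤-trans (n≤1+n _) (≤-reflexive e)))
           , (λ e → ≤⇒≯ (≮⇒≥ p) (≤-pred (≤-reflexive e)))

openGap-mono : ∀ g {y y'} → y < y' → openGap g y < openGap g y'
openGap-mono g {y} {y'} p with y <? g | y' <? g
... | yes _ | yes _ = p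
... | yes _ | no _ = ≤-trans p (≤-trans (n≤1+n y') (n≤1+n (suc y')))
... | no a | yes b = ⊥-elim (a (<-trans p b))
... | no _ | no _ = s≤s (s≤s p)

openGap-bound : ∀ g m y → y < m → openGap g y < suc (suc m)
openGap-bound g m y p with y <? g
... | yes _ = ≤-trans p (≤-trans (n≤1+n m) (n≤1+n (suc m)))
... | no _ = s≤s (s≤s p)

closeGap-bound : ∀ g m u → u < suc (suc m) → OffGap g u → g ≤ m → closeGap g u < m
closeGap-bound g m u p off g≤m with u <? g
... | yes q = ≤-trans q g≤m
... | no q = ≤-pred (≤-pred (subst (_< suc (suc m)) (sym (above-gap-∸2 (offGap-above (≮⇒≥ q) off))) p))

closeGap-mono : ∀ g {u u'} → u < u' → OffGap g u → OffGap g u' → closeGap g u < closeGap g u'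
closeGap-mono g {u} {u'} p off off' with u <? g | u' <? g
... | yes _ | yes _ = p
... | yes a | no b = let above = offGap-above (≮⇒≥ b) off' in
   ≤-trans a (above-gap-≤∸2 above)
... | no a | yes b = ⊥-elim (a (<-trans p b))
... | no a | no b = let above = offGap-above (≮⇒≥ a) off in
   ≤-pred (≤-pred (subst₂ _<_ (sym (above-gap-∸2 above)) (sym (above-gap-∸2 (<-trans above p))) p))

-- Moving the gap from {i, i+1} to {i+1, i+2} fixes every point except i+2,
-- which moves to i.  (Needed for idempotency of D(i, i+1).)
moveGap-up : ∀ i x → OffGap i x →
  ((x ≡ suc (suc i)) × (openGap (suc i) (closeGap i x) ≡ i)) ⊎ (openGap (suc i) (closeGap i x) ≡ x)
moveGap-up i x off with x <? i
... | yes p = inj₂ (openGap-below (≤-trans p (n≤1+n i)))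
... | no p with x ≟ suc (suc i)
... | yes refl = inj₁ (refl , openGap-below (n<1+n i))
... | no q = inj₂ (trans (openGap-above (above-gap-≤∸2 {suc i} above')) (above-gap-∸2 above))
  where
    above = offGap-above (≮⇒≥ p) off
    above' : suc (suc (suc i)) ≤ x
    above' = ≤∧≢⇒< above (λ e → q (sym e))

-- Moving the gap from {j+1, j+2} to {j, j+1} fixes every point except j,
-- which moves to j+2.  (Needed for idempotency of D(j+1, j).)
moveGap-down : ∀ j x → OffGap (suc j) x →
  ((x ≡ j) × (openGap j (closeGap (suc j) x) ≡ suc (suc j))) ⊎ (openGap j (closeGap (suc j) x) ≡ x)
moveGap-down j x off with x <? suc j
... | yes p with <-cmp x j
... | tri< p' _ _ = inj₂ (openGap-below p')
... | tri≈ _ e _ = inj₁ (e , trans (openGap-above (≤-reflexive (sym e))) (cong (λ w → suc (suc w)) e))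
... | tri> _ _ c = ⊥-elim (<⇒≱ p c)
moveGap-down j x off | no p =
  inj₂ (trans (openGap-above (≤-trans (n≤1+n j) (above-gap-≤∸2 above))) (above-gap-∸2 above))
  where above = offGap-above (≮⇒≥ p) off

length-filter-split : ∀ {A : Set} {P : A → Set} (P? : Decidable P) xs →
  length (filter P? xs) + length (filter (λ x → ¬? (P? x)) xs) ≡ length xs
length-filter-split P? [] = refl
length-filter-split P? (x ∷ xs) with P? x
... | yes _ = cong suc (length-filter-split P? xs)
... | no _ = trans (+-suc _ _) (cong suc (length-filter-split P? xs))

length-of-pair : ∀ {A : Set} {a b : A} (ys : List A) → Unique ys →
  (∀ z → z ∈ ys → (z ≡ a) ⊎ (z ≡ b)) → a ∈ ys → b ∈ ys → a ≢ b → length ys ≡ 2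
length-of-pair [] _ _ () _ _
length-of-pair (y ∷ []) _ _ (here refl) (here refl) a≢b = ⊥-elim (a≢b refl)
length-of-pair (y ∷ []) _ _ (here refl) (there ()) _
length-of-pair (y ∷ []) _ _ (there ()) _ _
length-of-pair (y₁ ∷ y₂ ∷ []) _ _ _ _ _ = refl
length-of-pair (y₁ ∷ y₂ ∷ y₃ ∷ ys) ((y₁≢y₂ ∷ y₁≢y₃ ∷ _) ∷ (y₂≢y₃ ∷ _) ∷ _) among _ _ _
  with among y₁ (here refl) | among y₂ (there (here refl)) | among y₃ (there (there (here refl)))
... | inj₁ p | inj₁ q | _ = ⊥-elim (y₁≢y₂ (trans p (sym q)))
... | inj₂ p | inj₂ q | _ = ⊥-elim (y₁≢y₂ (trans p (sym q)))
... | inj₁ p | inj₂ q | inj₁ r = ⊥-elim (y₁≢y₃ (trans p (sym r)))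
... | inj₁ p | inj₂ q | inj₂ r = ⊥-elim (y₂≢y₃ (trans q (sym r)))
... | inj₂ p | inj₁ q | inj₁ r = ⊥-elim (y₂≢y₃ (trans q (sym r)))
... | inj₂ p | inj₁ q | inj₂ r = ⊥-elim (y₁≢y₃ (trans p (sym r)))

length≡2 : ∀ {A : Set} (ys : List A) → length ys ≡ 2 → Σ A λ a → Σ A λ b → ys ≡ a ∷ b ∷ []
length≡2 (a ∷ b ∷ []) refl = a , b , refl

StrictlyIncreasingBelow : ℕ → (ℕ → ℕ) → Set
StrictlyIncreasingBelow M f = ∀ k → suc k < M → f k < f (suc k)

increasing-+ : ∀ {M f} → StrictlyIncreasingBelow M f → ∀ k d → k + d < M → f k + d ≤ f (k + d)
increasing-+ {M} {f} inc k zero p = ≤-reflexive (trans (+-identityʳ (f k)) (cong f (sym (+-identityʳ k))))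
increasing-+ {M} {f} inc k (suc d) p =
  subst₂ _≤_ (sym (+-suc (f k) d)) (cong f (sym (+-suc k d)))
    (≤-<-trans (increasing-+ inc k d (<-trans (+-monoʳ-< k (n<1+n d)) p)) (inc (k + d) (subst (_< M) (+-suc k d) p)))

increasing-< : ∀ {M f} → StrictlyIncreasingBelow M f → ∀ {k k'} → k < k' → k' < M → f k < f k'
increasing-< {M} {f} inc {k} {k'} p q =
  <-≤-trans (m<m+n (f k) 0<k'∸k) (subst (f k + (k' ∸ k) ≤_) (cong f e) (increasing-+ inc k (k' ∸ k) (subst (_< M) (sym e) q)))
  where
    e : k + (k' ∸ k) ≡ k'
    e = m+[n∸m]≡n (<⇒≤ p)
    0<k'∸k : 0 < k' ∸ k
    0<k'∸k = subst (_< k' ∸ k) (n∸n≡0 k) (∸-monoˡ-< p ≤-refl)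

first-nonfixed : (f : ℕ → ℕ) → ∀ M →
  (∀ t → t < M → f t ≡ t) ⊎ (Σ ℕ λ j → (j < M) × (f j ≢ j) × (∀ t → t < j → f t ≡ t))
first-nonfixed f zero = inj₁ (λ t ())
first-nonfixed f (suc M) with first-nonfixed f M
... | inj₂ (j , j<M , moved , fixed) = inj₂ (j , m≤n⇒m≤1+n j<M , moved , fixed)
... | inj₁ fixed with f M ≟ M
...   | no moved = inj₂ (M , n<1+n M , moved , fixed)
...   | yes e = inj₁ (λ t t<1+M → fixed′ t (m≤n⇒m<n∨m≡n (≤-pred t<1+M)))
  where
    fixed′ : ∀ t → (t < M) ⊎ (t ≡ M) → f t ≡ t
    fixed′ t (inj₁ t<M) = fixed t t<M
    fixed′ t (inj₂ refl) = e

-- read an index as an element of Fin (suc N) (meaningful below the bound)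
toFin : ∀ {N} → ℕ → Fin (suc N)
toFin zero = fzero
toFin {zero} (suc x) = fzero
toFin {suc N} (suc x) = fsuc (toFin {N} x)

toℕ-toFin : ∀ {N} x → x < suc N → toℕ (toFin {N} x) ≡ x
toℕ-toFin zero p = refl
toℕ-toFin {zero} (suc x) (s≤s ())
toℕ-toFin {suc N} (suc x) (s≤s p) = cong suc (toℕ-toFin {N} x p)

toFin-toℕ : ∀ {N} (a : Fin (suc N)) → toFin {N} (toℕ a) ≡ a
toFin-toℕ a = toℕ-injective (toℕ-toFin (toℕ a) (toℕ<n a))

-- Throughout, n = m + 2 and the vertex with index x < 2n is the upper vertex
-- x when x < n, and the lower vertex k' when x = n + k.
module RankMinusTwo (m : ℕ) where
  n : ℕ
  n = suc (suc m)

  twoN : ℕ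
  twoN = n + n

  upper<2n : ∀ {x} → x < n → x < twoN
  upper<2n p = ≤-trans p (m≤m+n n n)

  lower<2n : ∀ {k} → k < n → n + k < twoN
  lower<2n p = +-monoʳ-< n p

  data Row (x : ℕ) : Set where
    upper : x < n → Row x
    lower : ∀ k → k < n → x ≡ n + k → Row x

  row : ∀ x → x < twoN → Row x
  row x p with x <? n
  ... | yes q = upper q
  ... | no q = lower (x ∸ n) (subst (x ∸ n <_) (m+n∸m≡n n n) (∸-monoˡ-< p (≮⇒≥ q))) (sym (m+[n∸m]≡n (≮⇒≥ q)))

  -- position along the boundary (the function pos of Defs, on indices)
  bpos : ℕ → ℕ
  bpos x with x <? n
  ... | yes _ = x
  ... | no _ = (n + n ∸ 1) ∸ (x ∸ n)

  bpos-upper : ∀ {x} → x < n → bpos x ≡ x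
  bpos-upper {x} p with x <? n
  ... | yes _ = refl
  ... | no q = ⊥-elim (q p)

  bpos-lower : ∀ k → k < n → bpos (n + k) ≡ (suc m ∸ k) + n
  bpos-lower k p with (n + k) <? n
  ... | yes q = ⊥-elim (<⇒≱ q (m≤m+n n k))
  ... | no _ = trans (cong (suc m + n ∸_) (m+n∸m≡n n k)) (+-∸-comm n (≤-pred p))

  n≤bpos-lower : ∀ k → k < n → n ≤ bpos (n + k)
  n≤bpos-lower k p = subst (n ≤_) (sym (bpos-lower k p)) (m≤n+m n (suc m ∸ k))

  n≤bpos : ∀ z → n ≤ z → z < twoN → n ≤ bpos z
  n≤bpos z p q with row z q
  ... | upper r = ⊥-elim (<⇒≱ r p)
  ... | lower k r refl = n≤bpos-lower k r

  bpos-lower-anti : ∀ {k k'} → k < k' → k' < n → bpos (n + k') < bpos (n + k)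
  bpos-lower-anti {k} {k'} p q = subst₂ _<_ (sym (bpos-lower k' q)) (sym (bpos-lower k (<-trans p q)))
     (+-monoˡ-< n (∸-monoʳ-< p (≤-pred q)))

  bpos-lower-step : ∀ k → suc k < n → bpos (n + k) ≡ suc (bpos (n + suc k))
  bpos-lower-step k p = begin
    bpos (n + k)               ≡⟨ bpos-lower k (<-trans (n<1+n k) p) ⟩
    (suc m ∸ k) + n            ≡⟨ cong (_+ n) (+-∸-assoc 1 (≤-pred p)) ⟩
    suc (suc m ∸ suc k) + n    ≡⟨ cong suc (sym (bpos-lower (suc k) p)) ⟩
    suc (bpos (n + suc k))     ∎
    where open ≡-Reasoning

  bpos-anti : ∀ {a b} → n ≤ a → a < b → b < twoN → bpos b < bpos a
  bpos-anti {a} {b} p q r =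
    subst₂ _<_ (cong bpos (sym eb)) (cong bpos (sym ea))
      (bpos-lower-anti (+-cancelˡ-< n _ _ (subst₂ _<_ ea eb q)) (+-cancelˡ-< n _ _ (subst (_< twoN) eb r)))
    where
      ea : a ≡ n + (a ∸ n)
      ea = sym (m+[n∸m]≡n p)
      eb : b ≡ n + (b ∸ n)
      eb = sym (m+[n∸m]≡n (≤-trans p (<⇒≤ q)))

  -- the blocks {x, δ x} and {y, δ y} interleave along the boundary (the
  -- index form of the planarity condition of Defs)
  Crossing : (ℕ → ℕ) → ℕ → ℕ → Set
  Crossing δ x y = bpos x < bpos y × bpos y < bpos (δ x) × bpos (δ x) < bpos (δ y)

  -- The standard diagram D(i,j): cup {i, i+1}, cap {j', (j+1)'}, and the
  -- through strand x ↦ (φ x)' with φ = openGap j ∘ closeGap i.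
  module Standard (i j : ℕ) where
    φ : ℕ → ℕ
    φ u = openGap j (closeGap i u)

    ψ : ℕ → ℕ
    ψ k = openGap i (closeGap j k)

    upperPartner : ℕ → ℕ
    upperPartner x with x ≟ i
    ... | yes _ = suc i
    ... | no _ with x ≟ suc i
    ... | yes _ = i
    ... | no _ = n + φ x

    lowerPartner : ℕ → ℕ
    lowerPartner k with k ≟ j
    ... | yes _ = n + suc j
    ... | no _ with k ≟ suc j
    ... | yes _ = n + j
    ... | no _ = ψ k

    std : ℕ → ℕ
    std x with x <? n
    ... | yes _ = upperPartner x
    ... | no _ = lowerPartner (x ∸ n)

  module StandardFacts (i j : ℕ) (i≤m : i ≤ m) (j≤m : j ≤ m) where
    open Standard i j public

    i<n : i < n
    i<n = ≤-trans (s≤s i≤m) (n≤1+n (suc m))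
    i+1<n : suc i < n
    i+1<n = s≤s (s≤s i≤m)
    j<n : j < n
    j<n = ≤-trans (s≤s j≤m) (n≤1+n (suc m))
    j+1<n : suc j < n
    j+1<n = s≤s (s≤s j≤m)

    std-upper : ∀ {x} → x < n → std x ≡ upperPartner x
    std-upper {x} p with x <? n
    ... | yes _ = refl
    ... | no q = ⊥-elim (q p)

    std-lower : ∀ k → std (n + k) ≡ lowerPartner k
    std-lower k with (n + k) <? n
    ... | yes q = ⊥-elim (<⇒≱ q (m≤m+n n k))
    ... | no _ = cong lowerPartner (m+n∸m≡n n k)

    std-cupL : std i ≡ suc i
    std-cupL = trans (std-upper i<n) upper-i
      where
        upper-i : upperPartner i ≡ suc i
        upper-i with i ≟ i
        ... | yes _ = refl
        ... | no q = ⊥-elim (q refl)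

    std-cupR : std (suc i) ≡ i
    std-cupR = trans (std-upper i+1<n) upper-i+1
      where
        upper-i+1 : upperPartner (suc i) ≡ i
        upper-i+1 with suc i ≟ i
        ... | yes q = ⊥-elim (<⇒≢ (n<1+n i) (sym q))
        ... | no _ with suc i ≟ suc i
        ... | yes _ = refl
        ... | no q = ⊥-elim (q refl)

    std-upThrough : ∀ {x} → x < n → OffGap i x → std x ≡ n + φ x
    std-upThrough {x} p off = trans (std-upper p) (upper-through off)
      where
        upper-through : OffGap i x → upperPartner x ≡ n + φ x
        upper-through (x≢i , x≢i+1) with x ≟ i
        ... | yes q = ⊥-elim (x≢i q)
        ... | no _ with x ≟ suc i
        ... | yes q = ⊥-elim (x≢i+1 q)
        ... | no _ = refl

    std-capL : std (n + j) ≡ n + suc j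
    std-capL = trans (std-lower j) lower-j
      where
        lower-j : lowerPartner j ≡ n + suc j
        lower-j with j ≟ j
        ... | yes _ = refl
        ... | no q = ⊥-elim (q refl)

    std-capR : std (n + suc j) ≡ n + j
    std-capR = trans (std-lower (suc j)) lower-j+1
      where
        lower-j+1 : lowerPartner (suc j) ≡ n + j
        lower-j+1 with suc j ≟ j
        ... | yes q = ⊥-elim (<⇒≢ (n<1+n j) (sym q))
        ... | no _ with suc j ≟ suc j
        ... | yes _ = refl
        ... | no q = ⊥-elim (q refl)

    std-loThrough : ∀ {k} → OffGap j k → std (n + k) ≡ ψ k
    std-loThrough {k} off = trans (std-lower k) (lower-through off)
      where
        lower-through : OffGap j k → lowerPartner k ≡ ψ k
        lower-through (k≢j , k≢j+1) with k ≟ j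
        ... | yes q = ⊥-elim (k≢j q)
        ... | no _ with k ≟ suc j
        ... | yes q = ⊥-elim (k≢j+1 q)
        ... | no _ = refl

    φ<n : ∀ {x} → x < n → OffGap i x → φ x < n
    φ<n p off = openGap-bound j m _ (closeGap-bound i m _ p off i≤m)
    ψ<n : ∀ {k} → k < n → OffGap j k → ψ k < n
    ψ<n p off = openGap-bound i m _ (closeGap-bound j m _ p off j≤m)
    ψ∘φ : ∀ {x} → OffGap i x → ψ (φ x) ≡ x
    ψ∘φ {x} off = trans (cong (openGap i) (closeGap∘openGap j (closeGap i x))) (openGap∘closeGap i x off)
    φ∘ψ : ∀ {k} → OffGap j k → φ (ψ k) ≡ k
    φ∘ψ {k} off = trans (cong (openGap j) (closeGap∘openGap i (closeGap j k))) (openGap∘closeGap j k off)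
    φ-offGap : ∀ x → OffGap j (φ x)
    φ-offGap x = openGap-offGap j _
    ψ-offGap : ∀ k → OffGap i (ψ k)
    ψ-offGap k = openGap-offGap i _
    φ-mono : ∀ {x y} → x < y → OffGap i x → OffGap i y → φ x < φ y
    φ-mono p off off' = openGap-mono j (closeGap-mono i p off off')

    data Kind (x : ℕ) : Set where
      cupL : x ≡ i → Kind x
      cupR : x ≡ suc i → Kind x
      upThrough : x < n → OffGap i x → Kind x
      capL : x ≡ n + j → Kind x
      capR : x ≡ n + suc j → Kind x
      loThrough : ∀ k → k < n → OffGap j k → x ≡ n + k → Kind x

    kind : ∀ x → x < twoN → Kind x
    kind x p with row x p
    ... | upper q with x ≟ i
    ... | yes e = cupL e
    ... | no e with x ≟ suc i
    ... | yes e' = cupR e'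
    ... | no e' = upThrough q (e , e')
    kind x p | lower k q e with k ≟ j
    ... | yes f = capL (trans e (cong (n +_) f))
    ... | no f with k ≟ suc j
    ... | yes f' = capR (trans e (cong (n +_) f'))
    ... | no f' = loThrough k q (f , f') e

    std<2n : ∀ x → x < twoN → std x < twoN
    std<2n x p with kind x p
    ... | cupL refl = subst (_< twoN) (sym std-cupL) (upper<2n i+1<n)
    ... | cupR refl = subst (_< twoN) (sym std-cupR) (upper<2n i<n)
    ... | upThrough q off = subst (_< twoN) (sym (std-upThrough q off)) (lower<2n (φ<n q off))
    ... | capL refl = subst (_< twoN) (sym std-capL) (lower<2n j+1<n)
    ... | capR refl = subst (_< twoN) (sym std-capR) (lower<2n j<n)
    ... | loThrough k q off refl = subst (_< twoN) (sym (std-loThrough off)) (upper<2n (ψ<n q off))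

    std-involutive : ∀ x → x < twoN → std (std x) ≡ x
    std-involutive x p with kind x p
    ... | cupL refl = trans (cong std std-cupL) std-cupR
    ... | cupR refl = trans (cong std std-cupR) std-cupL
    ... | upThrough q off = trans (cong std (std-upThrough q off)) (trans (std-loThrough (φ-offGap x)) (ψ∘φ off))
    ... | capL refl = trans (cong std std-capL) std-capR
    ... | capR refl = trans (cong std std-capR) std-capL
    ... | loThrough k q off refl =
      trans (cong std (std-loThrough off)) (trans (std-upThrough (ψ<n q off) (ψ-offGap k)) (cong (n +_) (φ∘ψ off)))

    std-no-fixpoint : ∀ x → x < twoN → std x ≢ x
    std-no-fixpoint x p with kind x p
    ... | cupL refl = λ e → <⇒≢ (n<1+n i) (sym (trans (sym std-cupL) e))
    ... | cupR refl = λ e → <⇒≢ (n<1+n i) (trans (sym std-cupR) e)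
    ... | upThrough q off = λ e → <⇒≱ q (subst (n ≤_) (trans (sym (std-upThrough q off)) e) (m≤m+n n _))
    ... | capL refl = λ e → <⇒≢ (n<1+n j) (sym (+-cancelˡ-≡ n _ _ (trans (sym std-capL) e)))
    ... | capR refl = λ e → <⇒≢ (n<1+n j) (+-cancelˡ-≡ n _ _ (trans (sym std-capR) e))
    ... | loThrough k q off refl = λ e → <⇒≱ (ψ<n q off) (subst (n ≤_) (sym (trans (sym (std-loThrough off)) e)) (m≤m+n n k))

    -- blocks joining neighbours on the boundary cross nothing
    Adjacent : ℕ → Set
    Adjacent x = (bpos (std x) ≡ suc (bpos x)) ⊎ (suc (bpos (std x)) ≡ bpos x)

    adjacent-first : ∀ {x y} → Adjacent x → bpos x < bpos y → bpos y < bpos (std x) → ⊥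
    adjacent-first {x} {y} (inj₁ e) a b = <⇒≱ a (≤-pred (subst (bpos y <_) e b))
    adjacent-first {x} {y} (inj₂ e) a b = <-irrefl refl (<-trans a (<-trans b (≤-reflexive e)))

    adjacent-second : ∀ {x y} → Adjacent y → bpos y < bpos (std x) → bpos (std x) < bpos (std y) → ⊥
    adjacent-second {x} {y} (inj₁ e) a b = <⇒≱ a (≤-pred (subst (bpos (std x) <_) e b))
    adjacent-second {x} {y} (inj₂ e) a b = <-irrefl refl (<-trans a (<-trans b (≤-reflexive e)))

    adjacent-cupL : Adjacent i
    adjacent-cupL = inj₁ (trans (cong bpos std-cupL) (trans (bpos-upper i+1<n) (cong suc (sym (bpos-upper i<n)))))
    adjacent-cupR : Adjacent (suc i)
    adjacent-cupR = inj₂ (trans (cong (λ z → suc (bpos z)) std-cupR) (trans (cong suc (bpos-upper i<n)) (sym (bpos-upper i+1<n))))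
    adjacent-capL : Adjacent (n + j)
    adjacent-capL = inj₂ (trans (cong (λ z → suc (bpos z)) std-capL) (sym (bpos-lower-step j j+1<n)))
    adjacent-capR : Adjacent (n + suc j)
    adjacent-capR = inj₁ (trans (cong bpos std-capR) (bpos-lower-step j j+1<n))

    through-beyond : ∀ {k} → k < n → OffGap j k → ∀ z → z < n → bpos (std (n + k)) ≤ bpos (n + z)
    through-beyond {k} q off z z<n =
      subst (_≤ bpos (n + z)) (sym (trans (cong bpos (std-loThrough off)) (bpos-upper (ψ<n q off))))
        (≤-trans (<⇒≤ (ψ<n q off)) (n≤bpos-lower z z<n))

    std-planar : ∀ x y → x < twoN → y < twoN → ¬ Crossing std x y
    std-planar x y px py (a , b , c) with kind x px
    ... | cupL refl = adjacent-first {x = i} {y = y} adjacent-cupL a b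
    ... | cupR refl = adjacent-first {x = suc i} {y = y} adjacent-cupR a b
    ... | capL refl = adjacent-first {x = n + j} {y = y} adjacent-capL a b
    ... | capR refl = adjacent-first {x = n + suc j} {y = y} adjacent-capR a b
    ... | loThrough k q off refl = <⇒≱ (<-trans a b) (through-beyond q off k q)
    ... | upThrough q off with kind y py
    ...   | cupL refl = adjacent-second {x = x} {y = i} adjacent-cupL b c
    ...   | cupR refl = adjacent-second {x = x} {y = suc i} adjacent-cupR b c
    ...   | capL refl = adjacent-second {x = x} {y = n + j} adjacent-capL b c
    ...   | capR refl = adjacent-second {x = x} {y = n + suc j} adjacent-capR b c
    ...   | loThrough k q' off' refl =
              <⇒≱ c (subst (bpos (std (n + k)) ≤_) (sym (cong bpos (std-upThrough q off))) (through-beyond q' off' (φ x) (φ<n q off)))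
    ...   | upThrough q' off' = <⇒≱ c (subst₂ _≤_ (sym (cong bpos (std-upThrough q' off'))) (sym (cong bpos (std-upThrough q off)))
              (<⇒≤ (bpos-lower-anti (φ-mono (subst₂ _<_ (bpos-upper q) (bpos-upper q') a) off off') (φ<n q' off'))))

    cup-position : ∀ x → suc x < n → std x ≡ suc x → x ≡ i
    cup-position x p e with kind x (upper<2n (<-trans (n<1+n x) p))
    ... | cupL e' = e'
    ... | cupR refl = ⊥-elim (<⇒≢ (≤-trans (n<1+n i) (n≤1+n _)) (trans (sym std-cupR) e))
    ... | upThrough q off = ⊥-elim (<⇒≱ p (subst (n ≤_) (trans (sym (std-upThrough q off)) e) (m≤m+n n _)))
    ... | capL e' = ⊥-elim (<⇒≱ (<-trans (n<1+n x) p) (subst (n ≤_) (sym e') (m≤m+n n _)))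
    ... | capR e' = ⊥-elim (<⇒≱ (<-trans (n<1+n x) p) (subst (n ≤_) (sym e') (m≤m+n n _)))
    ... | loThrough k _ _ e' = ⊥-elim (<⇒≱ (<-trans (n<1+n x) p) (subst (n ≤_) (sym e') (m≤m+n n _)))

    cap-position : ∀ x → suc x < n → std (n + x) ≡ n + suc x → x ≡ j
    cap-position x p e with kind (n + x) (lower<2n (<-trans (n<1+n x) p))
    ... | cupL e' = ⊥-elim (<⇒≱ (subst (_< n) (sym e') i<n) (m≤m+n n x))
    ... | cupR e' = ⊥-elim (<⇒≱ (subst (_< n) (sym e') i+1<n) (m≤m+n n x))
    ... | upThrough q _ = ⊥-elim (<⇒≱ q (m≤m+n n x))
    ... | capL e' = +-cancelˡ-≡ n _ _ e'
    ... | capR e' = ⊥-elim (<⇒≢ (≤-trans (n<1+n j) (n≤1+n _)) (+-cancelˡ-≡ n _ _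
            (trans (sym (trans (cong std e') std-capR)) (trans e (cong (λ z → n + suc z) (+-cancelˡ-≡ n _ _ e'))))))
    ... | loThrough k q off e' = ⊥-elim (<⇒≱ (ψ<n q off) (subst (n ≤_) (trans (sym e) (trans (cong std e') (std-loThrough off))) (m≤m+n n _)))

  vertex : ℕ → Pt n
  vertex = toFin

  column : ℕ → Fin n
  column = toFin

  toℕ-upper : ∀ {a : Pt n} {u} → splitAt n a ≡ inj₁ u → toℕ a ≡ toℕ u
  toℕ-upper {a} {u} eq = trans (cong toℕ (sym (splitAt⁻¹-↑ˡ {i = a} eq))) (toℕ-↑ˡ u n)

  toℕ-lower : ∀ {a : Pt n} {k} → splitAt n a ≡ inj₂ k → toℕ a ≡ n + toℕ k
  toℕ-lower {a} {k} eq = trans (cong toℕ (sym (splitAt⁻¹-↑ʳ {i = a} eq))) (toℕ-↑ʳ n k)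

  pos-bpos : ∀ (a : Pt n) → pos {n} a ≡ bpos (toℕ a)
  pos-bpos a with splitAt n a in eq
  ... | inj₁ u = sym (trans (cong bpos (toℕ-upper {a} eq)) (bpos-upper (toℕ<n u)))
  ... | inj₂ k = sym (trans (cong bpos (toℕ-lower {a} eq)) lower-pos)
    where
      lower-pos : bpos (n + toℕ k) ≡ (n + n ∸ 1) ∸ toℕ k
      lower-pos with (n + toℕ k) <? n
      ... | yes q = ⊥-elim (<⇒≱ q (m≤m+n n _))
      ... | no _ = cong ((n + n ∸ 1) ∸_) (m+n∸m≡n n (toℕ k))

  -- vertices of the glued graph as indices below 3n: top row, middle row, bottom row
  vertexCode : GV n → ℕ
  vertexCode (top u) = toℕ u
  vertexCode (mid k) = n + toℕ k
  vertexCode (bot k) = n + n + toℕ k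

  vertexCode-injective : ∀ {v w} → vertexCode v ≡ vertexCode w → v ≡ w
  vertexCode-injective {top u} {top u'} e = cong top (toℕ-injective e)
  vertexCode-injective {top u} {mid k} e = ⊥-elim (<⇒≱ (toℕ<n u) (subst (n ≤_) (sym e) (m≤m+n n _)))
  vertexCode-injective {top u} {bot k} e = ⊥-elim (<⇒≱ (toℕ<n u) (subst (n ≤_) (sym e) (≤-trans (m≤m+n n n) (m≤m+n (n + n) _))))
  vertexCode-injective {mid k} {top u} e = ⊥-elim (<⇒≱ (toℕ<n u) (subst (n ≤_) e (m≤m+n n _)))
  vertexCode-injective {mid k} {mid k'} e = cong mid (toℕ-injective (+-cancelˡ-≡ n _ _ e))
  vertexCode-injective {mid k} {bot k'} e =
    ⊥-elim (<⇒≱ (toℕ<n k) (subst (n ≤_) (sym (+-cancelˡ-≡ n _ _ (trans e (+-assoc n n _)))) (m≤m+n n _)))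
  vertexCode-injective {bot k} {top u} e = ⊥-elim (<⇒≱ (toℕ<n u) (subst (n ≤_) e (≤-trans (m≤m+n n n) (m≤m+n (n + n) _))))
  vertexCode-injective {bot k} {mid k'} e =
    ⊥-elim (<⇒≱ (toℕ<n k') (subst (n ≤_) (+-cancelˡ-≡ n _ _ (trans (sym (+-assoc n n _)) e)) (m≤m+n n _)))
  vertexCode-injective {bot k} {bot k'} e = cong bot (toℕ-injective (+-cancelˡ-≡ (n + n) _ _ e))

  vertexCode-emb₁ : ∀ (a : Pt n) → vertexCode (emb₁ {n} a) ≡ toℕ a
  vertexCode-emb₁ a with splitAt n a in eq
  ... | inj₁ u = sym (toℕ-upper {a} eq)
  ... | inj₂ k = sym (toℕ-lower {a} eq)

  vertexCode-emb₂ : ∀ (a : Pt n) → vertexCode (emb₂ {n} a) ≡ n + toℕ a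
  vertexCode-emb₂ a with splitAt n a in eq
  ... | inj₁ u = cong (n +_) (sym (toℕ-upper {a} eq))
  ... | inj₂ k = trans (+-assoc n n _) (cong (n +_) (sym (toℕ-lower {a} eq)))

  outerCode : ℕ → ℕ
  outerCode x with x <? n
  ... | yes _ = x
  ... | no _ = n + x

  outerCode-upper : ∀ {x} → x < n → outerCode x ≡ x
  outerCode-upper {x} p with x <? n
  ... | yes _ = refl
  ... | no q = ⊥-elim (q p)

  outerCode-lower : ∀ k → outerCode (n + k) ≡ n + (n + k)
  outerCode-lower k with (n + k) <? n
  ... | yes q = ⊥-elim (<⇒≱ q (m≤m+n n k))
  ... | no _ = refl

  vertexCode-outer : ∀ (a : Pt n) → vertexCode (outer {n} a) ≡ outerCode (toℕ a)
  vertexCode-outer a with splitAt n a in eq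
  ... | inj₁ u = trans (sym (outerCode-upper (toℕ<n u))) (cong outerCode (sym (toℕ-upper {a} eq)))
  ... | inj₂ k = trans (trans (+-assoc n n _) (sym (outerCode-lower (toℕ k)))) (cong outerCode (sym (toℕ-lower {a} eq)))

  middle : ℕ → GV n
  middle k = mid (column k)

  vertexCode-middle : ∀ {k} → k < n → vertexCode (middle k) ≡ n + k
  vertexCode-middle {k} p = cong (n +_) (toℕ-toFin k p)

  fromIndices : (ℕ → ℕ) → Diagram n
  fromIndices F = tabulate (λ a → vertex (F (toℕ a)))

  partner-fromIndices : ∀ {F} → (∀ x → x < twoN → F x < twoN) → ∀ a → toℕ (partner {n} (fromIndices F) a) ≡ F (toℕ a)
  partner-fromIndices {F} F<2n a =
    trans (cong toℕ (lookup∘tabulate (λ b → vertex (F (toℕ b))) a)) (toℕ-toFin _ (F<2n _ (toℕ<n a)))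

  fromIndices-cong : ∀ {F G} → (∀ x → x < twoN → F x ≡ G x) → fromIndices F ≡ fromIndices G
  fromIndices-cong F≗G = tabulate-cong (λ a → cong vertex (F≗G (toℕ a) (toℕ<n a)))

  module Indexed (d : Diagram n) (F : ℕ → ℕ) (partner-F : ∀ a → toℕ (partner {n} d a) ≡ F (toℕ a)) where
    partner-vertex : ∀ x → x < twoN → toℕ (partner {n} d (vertex x)) ≡ F x
    partner-vertex x p = trans (partner-F _) (cong F (toℕ-toFin x p))

    F<2n : ∀ x → x < twoN → F x < twoN
    F<2n x p = subst (_< twoN) (partner-vertex x p) (toℕ<n _)

    determined : d ≡ fromIndices F
    determined = trans (sym (tabulate∘lookup d))
      (tabulate-cong (λ a → toℕ-injective (trans (partner-F a) (sym (toℕ-toFin _ (F<2n _ (toℕ<n a)))))))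

    involutive-from-indices : (∀ x → x < twoN → F (F x) ≡ x) → ∀ a → partner {n} d (partner {n} d a) ≡ a
    involutive-from-indices inv a = toℕ-injective (trans (partner-F _) (trans (cong F (partner-F a)) (inv _ (toℕ<n a))))

    involutive-to-indices : (∀ a → partner {n} d (partner {n} d a) ≡ a) → ∀ x → x < twoN → F (F x) ≡ x
    involutive-to-indices inv x p = begin
      F (F x)                                                 ≡⟨ sym (partner-vertex (F x) (F<2n x p)) ⟩
      toℕ (partner {n} d (vertex (F x)))                      ≡⟨ cong (λ z → toℕ (partner {n} d (vertex z))) (sym (partner-vertex x p)) ⟩
      toℕ (partner {n} d (vertex (toℕ (partner {n} d (vertex x))))) ≡⟨ cong (λ z → toℕ (partner {n} d z)) (toFin-toℕ _) ⟩
      toℕ (partner {n} d (partner {n} d (vertex x)))          ≡⟨ cong toℕ (inv _) ⟩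
      toℕ (vertex x)                                          ≡⟨ toℕ-toFin x p ⟩
      x                                                       ∎
      where open ≡-Reasoning

    no-fixpoint-from-indices : (∀ x → x < twoN → F x ≢ x) → ∀ a → ¬ (partner {n} d a ≡ a)
    no-fixpoint-from-indices nf a e = nf _ (toℕ<n a) (trans (sym (partner-F a)) (cong toℕ e))

    no-fixpoint-to-indices : (∀ a → ¬ (partner {n} d a ≡ a)) → ∀ x → x < twoN → F x ≢ x
    no-fixpoint-to-indices nf x p e = nf (vertex x) (toℕ-injective (trans (partner-vertex x p) (trans e (sym (toℕ-toFin x p)))))

    pos-vertex : ∀ x → x < twoN → pos {n} (vertex x) ≡ bpos x
    pos-vertex x p = trans (pos-bpos (vertex x)) (cong bpos (toℕ-toFin x p))

    pos-partner : ∀ a → pos {n} (partner {n} d a) ≡ bpos (F (toℕ a))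
    pos-partner a = trans (pos-bpos (partner {n} d a)) (cong bpos (partner-F a))

    planar-from-indices : (∀ x y → x < twoN → y < twoN → ¬ Crossing F x y) → IsPlanar {n} d
    planar-from-indices noCross a c p q r = noCross (toℕ a) (toℕ c) (toℕ<n a) (toℕ<n c)
      ( subst₂ _<_ (pos-bpos a) (pos-bpos c) p
      , subst₂ _<_ (pos-bpos c) (pos-partner a) q
      , subst₂ _<_ (pos-partner a) (pos-partner c) r)

    planar-to-indices : IsPlanar {n} d → ∀ x y → x < twoN → y < twoN → ¬ Crossing F x y
    planar-to-indices planar x y px py (a , b , c) = planar (vertex x) (vertex y)
      (subst₂ _<_ (sym (pos-vertex x px)) (sym (pos-vertex y py)) a)
      (subst₂ _<_ (sym (pos-vertex y py)) (sym (pos-partner-vertex x px)) b)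
      (subst₂ _<_ (sym (pos-partner-vertex x px)) (sym (pos-partner-vertex y py)) c)
      where
        pos-partner-vertex : ∀ z → z < twoN → pos {n} (partner {n} d (vertex z)) ≡ bpos (F z)
        pos-partner-vertex z p = trans (pos-bpos (partner {n} d (vertex z))) (cong bpos (partner-vertex z p))

    upperEdge : ∀ x → x < twoN → ∀ {v w} → vertexCode v ≡ x → vertexCode w ≡ F x → Edge {n} d d v w
    upperEdge x p {v} {w} ev ew =
      inj₁ (vertex x , sym (vertexCode-injective (trans ev (sym e₁))) , sym (vertexCode-injective (trans ew (sym e₂))))
      where
        e₁ : vertexCode (emb₁ {n} (vertex x)) ≡ x
        e₁ = trans (vertexCode-emb₁ _) (toℕ-toFin x p)
        e₂ : vertexCode (emb₁ {n} (partner {n} d (vertex x))) ≡ F x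
        e₂ = trans (vertexCode-emb₁ _) (partner-vertex x p)

    lowerEdge : ∀ x → x < twoN → ∀ {v w} → vertexCode v ≡ n + x → vertexCode w ≡ n + F x → Edge {n} d d v w
    lowerEdge x p {v} {w} ev ew =
      inj₂ (vertex x , sym (vertexCode-injective (trans ev (sym e₁))) , sym (vertexCode-injective (trans ew (sym e₂))))
      where
        e₁ : vertexCode (emb₂ {n} (vertex x)) ≡ n + x
        e₁ = trans (vertexCode-emb₂ _) (cong (n +_) (toℕ-toFin x p))
        e₂ : vertexCode (emb₂ {n} (partner {n} d (vertex x))) ≡ n + F x
        e₂ = trans (vertexCode-emb₂ _) (cong (n +_) (partner-vertex x p))

    label-invariant : (c : ℕ → ℕ) → (∀ x → x < twoN → c x ≡ c (F x)) → (∀ x → x < twoN → c (n + x) ≡ c (n + F x)) →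
                      ∀ {v w} → Connected {n} d d v w → c (vertexCode v) ≡ c (vertexCode w)
    label-invariant c onUpper onLower ε = refl
    label-invariant c onUpper onLower (inj₁ (a , refl , refl) ◅ r) =
      trans (trans (cong c (vertexCode-emb₁ a))
                   (trans (onUpper _ (toℕ<n a)) (cong c (trans (sym (partner-F a)) (sym (vertexCode-emb₁ _))))))
            (label-invariant c onUpper onLower r)
    label-invariant c onUpper onLower (inj₂ (a , refl , refl) ◅ r) =
      trans (trans (cong c (vertexCode-emb₂ a))
                   (trans (onLower _ (toℕ<n a)) (cong c (trans (cong (n +_) (sym (partner-F a))) (sym (vertexCode-emb₂ _))))))
            (label-invariant c onUpper onLower r)

    edge-sym : (∀ a → partner {n} d (partner {n} d a) ≡ a) → ∀ {v w} → Edge {n} d d v w → Edge {n} d d w v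
    edge-sym inv (inj₁ (a , e₁ , e₂)) = inj₁ (partner {n} d a , e₂ , trans (cong emb₁ (inv a)) e₁)
    edge-sym inv (inj₂ (a , e₁ , e₂)) = inj₂ (partner {n} d a , e₂ , trans (cong emb₂ (inv a)) e₁)

  ToLower : Diagram n → Fin n → Set
  ToLower d u = n ≤ toℕ (partner {n} d (u ↑ˡ n))

  toLower? : ∀ d → Decidable (ToLower d)
  toLower? d u = n ≤? toℕ (partner {n} d (u ↑ˡ n))

  cupColumns : Diagram n → List (Fin n)
  cupColumns d = filter (λ u → ¬? (toLower? d u)) (allFin n)

  cupColumns-unique : ∀ d → Unique (cupColumns d)
  cupColumns-unique d = filter⁺ (λ u → ¬? (toLower? d u)) (allFin⁺ n)

  ∈-cupColumns : ∀ d {u} → ¬ ToLower d u → u ∈ cupColumns d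
  ∈-cupColumns d {u} ¬low = ∈-filter⁺ (λ u → ¬? (toLower? d u)) (∈-allFin u) ¬low

  cupColumns-∈ : ∀ d {u} → u ∈ cupColumns d → ¬ ToLower d u
  cupColumns-∈ d u∈ = proj₂ (∈-filter⁻ (λ u → ¬? (toLower? d u)) {xs = allFin n} u∈)

  rank+cupColumns : ∀ d → rank {n} d + length (cupColumns d) ≡ m + 2
  rank+cupColumns d = trans (length-filter-split (toLower? d) (allFin n)) (trans (length-tabulate {n = n} (λ u → u)) (+-comm 2 m))

  rank≡m⇒two-cupColumns : ∀ d → rank {n} d ≡ m → length (cupColumns d) ≡ 2
  rank≡m⇒two-cupColumns d r = +-cancelˡ-≡ m _ _ (trans (cong (_+ length (cupColumns d)) (sym r)) (rank+cupColumns d))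

  two-cupColumns⇒rank≡m : ∀ d → length (cupColumns d) ≡ 2 → rank {n} d ≡ m
  two-cupColumns⇒rank≡m d two = +-cancelʳ-≡ 2 _ _ (trans (cong (rank {n} d +_) (sym two)) (rank+cupColumns d))

  standard : ℕ → ℕ → Diagram n
  standard i j = fromIndices (Standard.std i j)

  module StandardDiagram (i j : ℕ) (i≤m : i ≤ m) (j≤m : j ≤ m) where
    open StandardFacts i j i≤m j≤m public

    D : Diagram n
    D = standard i j

    partner-std : ∀ a → toℕ (partner {n} D a) ≡ std (toℕ a)
    partner-std = partner-fromIndices std<2n

    open Indexed D std partner-std public

    partner-involutive : ∀ a → partner {n} D (partner {n} D a) ≡ a
    partner-involutive = involutive-from-indices std-involutive

    standard-Jones : IsJones {n} D
    standard-Jones = (λ a → partner-involutive a , no-fixpoint-from-indices std-no-fixpoint a)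
                   , planar-from-indices std-planar

    -- the cup columns of D(i,j) are i and i + 1
    standard-rank : rank {n} D ≡ m
    standard-rank = two-cupColumns⇒rank≡m D
      (length-of-pair (cupColumns D) (cupColumns-unique D) cups (∈-cupColumns D ¬low-i) (∈-cupColumns D ¬low-i+1) i≢i+1)
      where
        partner-column : ∀ u → toℕ (partner {n} D (u ↑ˡ n)) ≡ std (toℕ u)
        partner-column u = trans (partner-std (u ↑ˡ n)) (cong std (toℕ-↑ˡ u n))
        upper-partner : ∀ {x} → x < n → std x < n → ¬ ToLower D (column x)
        upper-partner {x} p q low = <⇒≱ (subst (_< n) (sym (trans (partner-column (column x)) (cong std (toℕ-toFin x p)))) q) low
        ¬low-i : ¬ ToLower D (column i)
        ¬low-i = upper-partner i<n (subst (_< n) (sym std-cupL) i+1<n)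
        ¬low-i+1 : ¬ ToLower D (column (suc i))
        ¬low-i+1 = upper-partner i+1<n (subst (_< n) (sym std-cupR) i<n)
        i≢i+1 : column i ≢ column (suc i)
        i≢i+1 e = <⇒≢ (n<1+n i) (trans (sym (toℕ-toFin i i<n)) (trans (cong toℕ e) (toℕ-toFin (suc i) i+1<n)))
        cups : ∀ u → u ∈ cupColumns D → (u ≡ column i) ⊎ (u ≡ column (suc i))
        cups u u∈ with kind (toℕ u) (upper<2n (toℕ<n u))
        ... | cupL e = inj₁ (toℕ-injective (trans e (sym (toℕ-toFin i i<n))))
        ... | cupR e = inj₂ (toℕ-injective (trans e (sym (toℕ-toFin (suc i) i+1<n))))
        ... | upThrough q off = ⊥-elim (cupColumns-∈ D u∈ (subst (n ≤_) (sym (trans (partner-column u) (std-upThrough q off))) (m≤m+n n _)))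
        ... | capL e = ⊥-elim (<⇒≱ (toℕ<n u) (subst (n ≤_) (sym e) (m≤m+n n _)))
        ... | capR e = ⊥-elim (<⇒≱ (toℕ<n u) (subst (n ≤_) (sym e) (m≤m+n n _)))
        ... | loThrough k _ _ e = ⊥-elim (<⇒≱ (toℕ<n u) (subst (n ≤_) (sym e) (m≤m+n n _)))

    blockKey : ℕ → ℕ
    blockKey x = x ⊓ std x

    blockKey-sym : ∀ x → x < twoN → blockKey (std x) ≡ blockKey x
    blockKey-sym x p = trans (cong (std x ⊓_) (std-involutive x p)) (⊓-comm (std x) x)

    blockKey-injective : ∀ x y → x < twoN → y < twoN → blockKey x ≡ blockKey y → (x ≡ y) ⊎ (std x ≡ y)
    blockKey-injective x y px py e with ⊓-sel x (std x) | ⊓-sel y (std y)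
    ... | inj₁ a | inj₁ b = inj₁ (trans (sym a) (trans e b))
    ... | inj₁ a | inj₂ b = inj₂ (trans (cong std (trans (sym a) (trans e b))) (std-involutive y py))
    ... | inj₂ a | inj₁ b = inj₂ (trans (sym a) (trans e b))
    ... | inj₂ a | inj₂ b = inj₁ (trans (sym (std-involutive x px)) (trans (cong std (trans (sym a) (trans e b))) (std-involutive y py)))

    -- Idempotency of D(i,j) is shown by labelling the glued graph of
    -- D(i,j)·D(i,j): an outer vertex is labelled by the key of its block in
    -- D(i,j), a middle vertex k by the key of middleLabel k, where the middle
    -- cup {i, i+1} is collapsed to a point τ.  Under the hypotheses below the
    -- labelling is constant along edges, so connected outer vertices lie in one
    -- block; conversely every block of D(i,j) is realised by an explicit path.
    module IdempotencyCriterion (τ : ℕ) where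
      middleLabel : ℕ → ℕ
      middleLabel k with k ≟ i
      ... | yes _ = τ
      ... | no _ with k ≟ suc i
      ... | yes _ = τ
      ... | no _ = k

      middleLabel-cupL : middleLabel i ≡ τ
      middleLabel-cupL with i ≟ i
      ... | yes _ = refl
      ... | no q = ⊥-elim (q refl)

      middleLabel-cupR : middleLabel (suc i) ≡ τ
      middleLabel-cupR with suc i ≟ i
      ... | yes _ = refl
      ... | no _ with suc i ≟ suc i
      ... | yes _ = refl
      ... | no q = ⊥-elim (q refl)

      middleLabel-off : ∀ {k} → OffGap i k → middleLabel k ≡ k
      middleLabel-off {k} (k≢i , k≢i+1) with k ≟ i
      ... | yes q = ⊥-elim (k≢i q)
      ... | no _ with k ≟ suc i
      ... | yes q = ⊥-elim (k≢i+1 q)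
      ... | no _ = refl

      labelBy : (c : ℕ) → Dec (c < n) → Dec (c < twoN) → ℕ
      labelBy c (yes _) _ = blockKey c
      labelBy c (no _) (yes _) = blockKey (middleLabel (c ∸ n))
      labelBy c (no _) (no _) = blockKey (c ∸ n)

      label : ℕ → ℕ
      label c = labelBy c (c <? n) (c <? twoN)

      label-top : ∀ {x} → x < n → label x ≡ blockKey x
      label-top {x} p = by (x <? n) (x <? twoN)
        where
          by : ∀ d₁ d₂ → labelBy x d₁ d₂ ≡ blockKey x
          by (yes _) _ = refl
          by (no q) _ = ⊥-elim (q p)

      label-middle : ∀ {k} → k < n → label (n + k) ≡ blockKey (middleLabel k)
      label-middle {k} p = by ((n + k) <? n) ((n + k) <? twoN)
        where
          by : ∀ d₁ d₂ → labelBy (n + k) d₁ d₂ ≡ blockKey (middleLabel k)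
          by (yes q) _ = ⊥-elim (<⇒≱ q (m≤m+n n k))
          by (no _) (yes _) = cong (λ z → blockKey (middleLabel z)) (m+n∸m≡n n k)
          by (no _) (no q) = ⊥-elim (q (+-monoʳ-< n p))

      label-bottom : ∀ k → label (n + (n + k)) ≡ blockKey (n + k)
      label-bottom k = by ((n + (n + k)) <? n) ((n + (n + k)) <? twoN)
        where
          by : ∀ d₁ d₂ → labelBy (n + (n + k)) d₁ d₂ ≡ blockKey (n + k)
          by (yes q) _ = ⊥-elim (<⇒≱ q (m≤m+n n _))
          by (no _) (yes q) = ⊥-elim (<⇒≱ q (subst (twoN ≤_) (+-assoc n n k) (m≤m+n twoN k)))
          by (no _) (no _) = cong blockKey (m+n∸m≡n n (n + k))

      label-outer : ∀ x → x < twoN → label (outerCode x) ≡ blockKey x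
      label-outer x p with row x p
      ... | upper q = trans (cong label (outerCode-upper q)) (label-top q)
      ... | lower k q refl = trans (cong label (outerCode-lower k)) (label-bottom k)

      module Invariance (cap-label : middleLabel j ≡ middleLabel (suc j))
                        (through-label : ∀ x → x < n → OffGap i x → middleLabel (φ x) ≡ x) where
        label-upperBlock-cup : ∀ x → x < n → std x < n → label x ≡ label (std x)
        label-upperBlock-cup x p q = trans (label-top p) (trans (sym (blockKey-sym x (upper<2n p))) (sym (label-top q)))

        label-upperBlock-upper : ∀ x → x < n → label x ≡ label (std x)
        label-upperBlock-upper x p with kind x (upper<2n p)
        ... | cupL refl = label-upperBlock-cup x p (subst (_< n) (sym std-cupL) i+1<n)
        ... | cupR refl = label-upperBlock-cup x p (subst (_< n) (sym std-cupR) i<n)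
        ... | upThrough q off = begin
          label x                        ≡⟨ label-top p ⟩
          blockKey x                     ≡⟨ cong blockKey (sym (through-label x q off)) ⟩
          blockKey (middleLabel (φ x))   ≡⟨ sym (label-middle (φ<n q off)) ⟩
          label (n + φ x)                ≡⟨ cong label (sym (std-upThrough q off)) ⟩
          label (std x)                  ∎
          where open ≡-Reasoning
        ... | capL refl = ⊥-elim (<⇒≱ p (m≤m+n n j))
        ... | capR refl = ⊥-elim (<⇒≱ p (m≤m+n n (suc j)))
        ... | loThrough k q off refl = ⊥-elim (<⇒≱ p (m≤m+n n k))

        label-upperBlock : ∀ x → x < twoN → label x ≡ label (std x)
        label-upperBlock x p with kind x p
        ... | cupL refl = label-upperBlock-upper x i<n
        ... | cupR refl = label-upperBlock-upper x i+1<n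
        ... | upThrough q off = label-upperBlock-upper x q
        ... | capL refl = trans (label-middle j<n) (trans (cong blockKey cap-label) (trans (sym (label-middle j+1<n)) (cong label (sym std-capL))))
        ... | capR refl = trans (label-middle j+1<n) (trans (cong blockKey (sym cap-label)) (trans (sym (label-middle j<n)) (cong label (sym std-capR))))
        ... | loThrough k q off refl =
          sym (trans (label-upperBlock-upper (std x) (subst (_< n) (sym (std-loThrough off)) (ψ<n q off))) (cong label (std-involutive x p)))

        label-lowerBlock-upper : ∀ x → x < n → label (n + x) ≡ label (n + std x)
        label-lowerBlock-upper x p with kind x (upper<2n p)
        ... | cupL refl = trans (label-middle i<n) (trans (cong blockKey (trans middleLabel-cupL (sym middleLabel-cupR)))
                            (trans (sym (label-middle i+1<n)) (cong (λ z → label (n + z)) (sym std-cupL))))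
        ... | cupR refl = trans (label-middle i+1<n) (trans (cong blockKey (trans middleLabel-cupR (sym middleLabel-cupL)))
                            (trans (sym (label-middle i<n)) (cong (λ z → label (n + z)) (sym std-cupR))))
        ... | upThrough q off = begin
          label (n + x)                  ≡⟨ label-middle q ⟩
          blockKey (middleLabel x)       ≡⟨ cong blockKey (middleLabel-off off) ⟩
          blockKey x                     ≡⟨ sym (blockKey-sym x (upper<2n q)) ⟩
          blockKey (std x)               ≡⟨ cong blockKey (std-upThrough q off) ⟩
          blockKey (n + φ x)             ≡⟨ sym (label-bottom (φ x)) ⟩
          label (n + (n + φ x))          ≡⟨ cong (λ z → label (n + z)) (sym (std-upThrough q off)) ⟩
          label (n + std x)              ∎
          where open ≡-Reasoning
        ... | capL refl = ⊥-elim (<⇒≱ p (m≤m+n n j))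
        ... | capR refl = ⊥-elim (<⇒≱ p (m≤m+n n (suc j)))
        ... | loThrough k q off refl = ⊥-elim (<⇒≱ p (m≤m+n n k))

        label-lowerBlock-cap : ∀ k k' → n + k < twoN → std (n + k) ≡ n + k' → label (n + (n + k)) ≡ label (n + std (n + k))
        label-lowerBlock-cap k k' p e =
          trans (label-bottom k) (trans (sym (blockKey-sym (n + k) p))
            (trans (cong blockKey e) (trans (sym (label-bottom k')) (cong (λ z → label (n + z)) (sym e)))))

        label-lowerBlock : ∀ x → x < twoN → label (n + x) ≡ label (n + std x)
        label-lowerBlock x p with kind x p
        ... | cupL refl = label-lowerBlock-upper x i<n
        ... | cupR refl = label-lowerBlock-upper x i+1<n
        ... | upThrough q off = label-lowerBlock-upper x q
        ... | capL refl = label-lowerBlock-cap j (suc j) p std-capL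
        ... | capR refl = label-lowerBlock-cap (suc j) j p std-capR
        ... | loThrough k q off refl =
          sym (trans (label-lowerBlock-upper (std x) (subst (_< n) (sym (std-loThrough off)) (ψ<n q off)))
                     (cong (λ z → label (n + z)) (std-involutive x p)))

        connected⇒block : ∀ a b → Connected {n} D D (outer {n} a) (outer {n} b) → (a ≡ b) ⊎ (partner {n} D a ≡ b)
        connected⇒block a b conn with blockKey-injective (toℕ a) (toℕ b) (toℕ<n a) (toℕ<n b) same-key
          where
            same-key : blockKey (toℕ a) ≡ blockKey (toℕ b)
            same-key = begin
              blockKey (toℕ a)                ≡⟨ sym (label-outer _ (toℕ<n a)) ⟩
              label (outerCode (toℕ a))       ≡⟨ cong label (sym (vertexCode-outer a)) ⟩
              label (vertexCode (outer {n} a)) ≡⟨ label-invariant label label-upperBlock label-lowerBlock conn ⟩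
              label (vertexCode (outer {n} b)) ≡⟨ cong label (vertexCode-outer b) ⟩
              label (outerCode (toℕ b))       ≡⟨ label-outer _ (toℕ<n b) ⟩
              blockKey (toℕ b)                ∎
              where open ≡-Reasoning
        ... | inj₁ e = inj₁ (toℕ-injective e)
        ... | inj₂ e = inj₂ (toℕ-injective (trans (partner-std a) e))

      -- A through strand x of the upper copy
      -- reaches the middle vertex φ x; either the lower copy continues it
      -- straight down, or it detours through the middle cup and cap.
      Detour : ℕ → Set
      Detour x = (φ x ≡ x) ⊎ (Σ ℕ λ c → (c < n) × (std (φ x) ≡ c) × (std (n + c) ≡ n + x))

      module Paths (detour : ∀ x → x < n → OffGap i x → Detour x) where
        path-upThrough : ∀ x → x < n → OffGap i x → ∀ {v w} →
          vertexCode v ≡ outerCode x → vertexCode w ≡ outerCode (std x) → Connected {n} D D v w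
        path-upThrough x q off {v} {w} ev ew with detour x q off
        ... | inj₁ e =
              upperEdge x (upper<2n q) {v} {middle (φ x)} start toMiddle
            ◅ lowerEdge x (upper<2n q) {middle (φ x)} {w} (trans (vertexCode-middle φx<n) (cong (n +_) e)) end
            ◅ ε
          where
            φx<n = φ<n q off
            start = trans ev (outerCode-upper q)
            end = trans ew (trans (cong outerCode (std-upThrough q off)) (trans (outerCode-lower (φ x)) (cong (n +_) (sym (std-upThrough q off)))))
            toMiddle = trans (vertexCode-middle φx<n) (sym (std-upThrough q off))
        ... | inj₂ (c , c<n , cup , cap) =
              upperEdge x (upper<2n q) {v} {middle (φ x)} start toMiddle
            ◅ lowerEdge (φ x) (upper<2n φx<n) {middle (φ x)} {middle c} (vertexCode-middle φx<n) (trans (vertexCode-middle c<n) (cong (n +_) (sym cup)))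
            ◅ upperEdge (n + c) (lower<2n c<n) {middle c} {middle x} (vertexCode-middle c<n) (trans (vertexCode-middle q) (sym cap))
            ◅ lowerEdge x (upper<2n q) {middle x} {w} (vertexCode-middle q) end
            ◅ ε
          where
            φx<n = φ<n q off
            start = trans ev (outerCode-upper q)
            end = trans ew (trans (cong outerCode (std-upThrough q off)) (trans (outerCode-lower (φ x)) (cong (n +_) (sym (std-upThrough q off)))))
            toMiddle = trans (vertexCode-middle φx<n) (sym (std-upThrough q off))

        path-block : ∀ x → x < twoN → ∀ {v w} → vertexCode v ≡ outerCode x → vertexCode w ≡ outerCode (std x) → Connected {n} D D v w
        path-block x p {v} {w} ev ew with kind x p
        ... | cupL refl = upperEdge x p (trans ev (outerCode-upper i<n)) (trans ew (outerCode-upper (subst (_< n) (sym std-cupL) i+1<n))) ◅ ε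
        ... | cupR refl = upperEdge x p (trans ev (outerCode-upper i+1<n)) (trans ew (outerCode-upper (subst (_< n) (sym std-cupR) i<n))) ◅ ε
        ... | capL refl = lowerEdge x p (trans ev (outerCode-lower j))
                            (trans ew (trans (cong outerCode std-capL) (trans (outerCode-lower (suc j)) (cong (n +_) (sym std-capL))))) ◅ ε
        ... | capR refl = lowerEdge x p (trans ev (outerCode-lower (suc j)))
                            (trans ew (trans (cong outerCode std-capR) (trans (outerCode-lower j) (cong (n +_) (sym std-capR))))) ◅ ε
        ... | upThrough q off = path-upThrough x q off ev ew
        ... | loThrough k q off refl =
          reverse (edge-sym partner-involutive)
            (path-upThrough (std x) (subst (_< n) (sym (std-loThrough off)) (ψ<n q off)) (subst (OffGap i) (sym (std-loThrough off)) (ψ-offGap k))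
              ew (trans ev (cong outerCode (sym (std-involutive x p)))))

        block⇒connected : ∀ a b → (a ≡ b) ⊎ (partner {n} D a ≡ b) → Connected {n} D D (outer {n} a) (outer {n} b)
        block⇒connected a b (inj₁ refl) = ε
        block⇒connected a b (inj₂ refl) =
          path-block (toℕ a) (toℕ<n a) (vertexCode-outer a) (trans (vertexCode-outer (partner {n} D a)) (cong outerCode (partner-std a)))

      idempotent : middleLabel j ≡ middleLabel (suc j) → (∀ x → x < n → OffGap i x → middleLabel (φ x) ≡ x) →
                   (∀ x → x < n → OffGap i x → Detour x) → IsIdempotent {n} D
      idempotent cap-label through-label detour a b =
        mk⇔ (Invariance.connected⇒block cap-label through-label a b) (Paths.block⇒connected detour a b)

  -- D(i,i): the middle cup and cap coincide and φ is the identity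
  idempotent-diagonal : ∀ i (i≤m : i ≤ m) → IsIdempotent {n} (standard i i)
  idempotent-diagonal i i≤m =
    idempotent (trans middleLabel-cupL (sym middleLabel-cupR))
               (λ x _ off → trans (cong middleLabel (openGap∘closeGap i x off)) (middleLabel-off off))
               (λ x _ off → inj₁ (openGap∘closeGap i x off))
    where
      open StandardDiagram i i i≤m i≤m
      open IdempotencyCriterion i

  -- D(i,i+1): collapse the middle cup onto i + 2; the strand from i + 2 detours
  idempotent-above : ∀ i (i+1≤m : suc i ≤ m) → IsIdempotent {n} (standard i (suc i))
  idempotent-above i i+1≤m = idempotent (trans middleLabel-cupR (sym (middleLabel-off i+2-off))) through-label detour
    where
      open StandardDiagram i (suc i) (≤-trans (n≤1+n i) i+1≤m) i+1≤m
      open IdempotencyCriterion (suc (suc i))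
      i+2-off : OffGap i (suc (suc i))
      i+2-off = (λ e → <⇒≢ (≤-trans (n<1+n i) (n≤1+n (suc i))) (sym e)) , (λ e → <⇒≢ (n<1+n (suc i)) (sym e))
      through-label : ∀ x → x < n → OffGap i x → middleLabel (φ x) ≡ x
      through-label x _ off with moveGap-up i x off
      ... | inj₁ (refl , e) = trans (cong middleLabel e) middleLabel-cupL
      ... | inj₂ e = trans (cong middleLabel e) (middleLabel-off off)
      detour : ∀ x → x < n → OffGap i x → Detour x
      detour x _ off with moveGap-up i x off
      ... | inj₁ (refl , e) = inj₂ (suc i , i+1<n , trans (cong std e) std-cupL , std-capL)
      ... | inj₂ e = inj₁ e

  -- D(j+1,j): collapse the middle cup onto j; the strand from j detours
  idempotent-below : ∀ j (j+1≤m : suc j ≤ m) → IsIdempotent {n} (standard (suc j) j)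
  idempotent-below j j+1≤m = idempotent (trans (middleLabel-off j-off) (sym middleLabel-cupL)) through-label detour
    where
      open StandardDiagram (suc j) j j+1≤m (≤-trans (n≤1+n j) j+1≤m)
      open IdempotencyCriterion j
      j-off : OffGap (suc j) j
      j-off = (λ e → <⇒≢ (n<1+n j) e) , (λ e → <⇒≢ (≤-trans (n<1+n j) (n≤1+n (suc j))) e)
      through-label : ∀ x → x < n → OffGap (suc j) x → middleLabel (φ x) ≡ x
      through-label x _ off with moveGap-down j x off
      ... | inj₁ (refl , e) = trans (cong middleLabel e) middleLabel-cupR
      ... | inj₂ e = trans (cong middleLabel e) (middleLabel-off off)
      detour : ∀ x → x < n → OffGap (suc j) x → Detour x
      detour x _ off with moveGap-down j x off
      ... | inj₁ (refl , e) = inj₂ (suc j , i<n , trans (cong std e) std-cupR , std-capR)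
      ... | inj₂ e = inj₁ e

  module JonesIndices (δ : ℕ → ℕ) (δ<2n : ∀ x → x < twoN → δ x < twoN)
                      (δ-involutive : ∀ x → x < twoN → δ (δ x) ≡ x)
                      (δ-no-fixpoint : ∀ x → x < twoN → δ x ≢ x)
                      (δ-planar : ∀ x y → x < twoN → y < twoN → ¬ Crossing δ x y) where

    UpperPairsAmong : ℕ → ℕ → Set
    UpperPairsAmong a b = ∀ x → x < n → δ x < n → (x ≡ a) ⊎ (x ≡ b)

    CupAt : ℕ → Set
    CupAt i = (i ≤ m) × (δ i ≡ suc i) × (∀ x → x < n → OffGap i x → n ≤ δ x)

    -- a block {i₀, i₁} with i₀ < i₁ on the upper row must be a cup (i₁ = i₀ + 1),
    -- since the block of i₀ + 1 would otherwise cross it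
    ordered-upper-block-is-cup : ∀ i₀ i₁ → i₀ < i₁ → i₁ < n → δ i₀ ≡ i₁ → UpperPairsAmong i₀ i₁ → Σ ℕ CupAt
    ordered-upper-block-is-cup i₀ i₁ p q e among with <-cmp (suc i₀) i₁
    ... | tri> _ _ c = ⊥-elim (<⇒≱ c p)
    ... | tri< c _ _ = ⊥-elim (δ-planar i₀ (suc i₀) (upper<2n (<-trans p q)) (upper<2n (<-trans c q))
            ( subst₂ _<_ (sym (bpos-upper (<-trans p q))) (sym (bpos-upper (<-trans c q))) (n<1+n i₀)
            , subst₂ _<_ (sym (bpos-upper (<-trans c q))) (sym (trans (cong bpos e) (bpos-upper q))) c
            , subst (_< bpos (δ (suc i₀))) (sym (trans (cong bpos e) (bpos-upper q)))
                (<-≤-trans q (n≤bpos _ goes-down (δ<2n _ (upper<2n (<-trans c q)))))))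
      where
        goes-down : n ≤ δ (suc i₀)
        goes-down with δ (suc i₀) <? n
        ... | no r = ≮⇒≥ r
        ... | yes r with among (suc i₀) (<-trans c q) r
        ...   | inj₁ g = ⊥-elim (<⇒≢ (n<1+n i₀) (sym g))
        ...   | inj₂ g = ⊥-elim (<⇒≢ c g)
    ... | tri≈ _ refl _ = i₀ , ≤-pred (≤-pred q) , e , others-down
      where
        others-down : ∀ x → x < n → OffGap i₀ x → n ≤ δ x
        others-down x r (x≢i₀ , x≢i₁) with δ x <? n
        ... | no s = ≮⇒≥ s
        ... | yes s with among x r s
        ...   | inj₁ g = ⊥-elim (x≢i₀ g)
        ...   | inj₂ g = ⊥-elim (x≢i₁ g)

    find-cup : ∀ a b → a < n → b < n → a ≢ b → δ a < n → UpperPairsAmong a b → Σ ℕ CupAt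
    find-cup a b a<n b<n a≢b δa<n among with among (δ a) δa<n (subst (_< n) (sym (δ-involutive a (upper<2n a<n))) a<n)
    ... | inj₁ e = ⊥-elim (δ-no-fixpoint a (upper<2n a<n) e)
    ... | inj₂ e with <-cmp a b
    ...   | tri< c _ _ = ordered-upper-block-is-cup a b c b<n e among
    ...   | tri≈ _ c _ = ⊥-elim (a≢b c)
    ...   | tri> _ _ c = ordered-upper-block-is-cup b a c a<n (trans (cong δ (sym e)) (δ-involutive a (upper<2n a<n)))
                           (λ x r s → swap (among x r s))

    -- With the cup at i fixed, strand t is the lower vertex joined to the
    -- t-th upper vertex off the cup.  Planarity makes strand increasing, so
    -- strand = openGap j for the first j it moves (or j = m).
    module AfterCup (i : ℕ) (i≤m : i ≤ m) (δ-cupL : δ i ≡ suc i) (others-down : ∀ x → x < n → OffGap i x → n ≤ δ x) where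
      i<n : i < n
      i<n = ≤-trans (s≤s i≤m) (n≤1+n _)

      δ-cupR : δ (suc i) ≡ i
      δ-cupR = trans (cong δ (sym δ-cupL)) (δ-involutive i (upper<2n i<n))

      strand : ℕ → ℕ
      strand t = δ (openGap i t) ∸ n

      openGap<n : ∀ {t} → t < m → openGap i t < n
      openGap<n {t} p = openGap-bound i m t p

      δ-openGap : ∀ {t} → t < m → δ (openGap i t) ≡ n + strand t
      δ-openGap {t} p = sym (m+[n∸m]≡n (others-down _ (openGap<n p) (openGap-offGap i t)))

      strand<n : ∀ {t} → t < m → strand t < n
      strand<n {t} p = +-cancelˡ-< n _ _ (subst (_< twoN) (δ-openGap p) (δ<2n _ (upper<2n (openGap<n p))))

      δ-strand : ∀ {t} → t < m → δ (n + strand t) ≡ openGap i t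
      δ-strand p = trans (cong δ (sym (δ-openGap p))) (δ-involutive _ (upper<2n (openGap<n p)))

      -- two upper vertices going down do so in order (else their blocks cross)
      downward-ordered : ∀ {x y} → x < y → y < n → n ≤ δ x → n ≤ δ y → δ x < δ y
      downward-ordered {x} {y} p q dx dy with <-cmp (δ x) (δ y)
      ... | tri< c _ _ = c
      ... | tri≈ _ e _ = ⊥-elim (<⇒≢ p (trans (sym (δ-involutive x (upper<2n (<-trans p q)))) (trans (cong δ e) (δ-involutive y (upper<2n q)))))
      ... | tri> _ _ c = ⊥-elim (δ-planar x y (upper<2n (<-trans p q)) (upper<2n q)
              ( subst₂ _<_ (sym (bpos-upper (<-trans p q))) (sym (bpos-upper q)) p
              , subst (_< bpos (δ x)) (sym (bpos-upper q)) (<-≤-trans q (n≤bpos _ dx (δ<2n _ (upper<2n (<-trans p q)))))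
              , bpos-anti dy c (δ<2n _ (upper<2n (<-trans p q)))))

      strand-increasing : StrictlyIncreasingBelow m strand
      strand-increasing k p = +-cancelˡ-< n _ _ (subst₂ _<_ (δ-openGap (<-trans (n<1+n k) p)) (δ-openGap p)
        (downward-ordered (openGap-mono i (n<1+n k)) (openGap<n p)
          (others-down _ (openGap<n (<-trans (n<1+n k) p)) (openGap-offGap i k)) (others-down _ (openGap<n p) (openGap-offGap i (suc k)))))

      strand-≥ : ∀ {t} → t < m → t ≤ strand t
      strand-≥ {t} p = ≤-trans (m≤n+m t (strand 0)) (increasing-+ strand-increasing 0 t p)

      -- m increasing values below n = m + 2: each exceeds its argument by at most two
      strand-≤ : ∀ {t} → t < m → strand t ≤ suc (suc t)
      strand-≤ {t} p = ≤-pred (+-cancelʳ-< d (strand t) (suc (suc (suc t))) room)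
        where
          d = m ∸ suc t
          e : suc t + d ≡ m
          e = m+[n∸m]≡n p
          room : strand t + d < suc (suc (suc t)) + d
          room = <-≤-trans (≤-<-trans (increasing-+ strand-increasing t d (≤-reflexive e)) (strand<n (≤-reflexive e)))
                           (≤-reflexive (cong (λ z → suc (suc z)) (sym e)))

      strand-onto : ∀ {k} → k < n → δ (n + k) < n → Σ ℕ λ t → (t < m) × (strand t ≡ k)
      strand-onto {k} q r = closeGap i u , closeGap-bound i m u r off i≤m ,
        trans (cong (λ z → δ z ∸ n) (openGap∘closeGap i u off)) (trans (cong (_∸ n) δu) (m+n∸m≡n n k))
        where
          u = δ (n + k)
          δu : δ u ≡ n + k
          δu = δ-involutive _ (lower<2n q)
          off : OffGap i u
          off = (λ e → <⇒≱ (subst (_< n) (trans (sym δ-cupL) (trans (cong δ (sym e)) δu)) (s≤s (s≤s i≤m))) (m≤m+n n k))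
              , (λ e → <⇒≱ (subst (_< n) (trans (sym δ-cupR) (trans (cong δ (sym e)) δu)) i<n) (m≤m+n n k))

      unreached-goes-across : ∀ {k} → k < n → (∀ t → t < m → strand t ≢ k) → n ≤ δ (n + k)
      unreached-goes-across {k} q unreached with δ (n + k) <? n
      ... | no r = ≮⇒≥ r
      ... | yes r with strand-onto q r
      ...   | t , t<m , e = ⊥-elim (unreached t t<m e)

      module LowerBlock (k : ℕ) (k<n : k < n) (across : n ≤ δ (n + k)) where
        w : ℕ
        w = δ (n + k) ∸ n

        δ-k : δ (n + k) ≡ n + w
        δ-k = sym (m+[n∸m]≡n across)

        w<n : w < n
        w<n = +-cancelˡ-< n _ _ (subst (_< twoN) δ-k (δ<2n _ (lower<2n k<n)))

        δ-w : δ (n + w) ≡ n + k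
        δ-w = trans (cong δ (sym δ-k)) (δ-involutive _ (lower<2n k<n))

        w≢k : w ≢ k
        w≢k e = δ-no-fixpoint _ (lower<2n k<n) (trans δ-k (cong (n +_) e))

      module FirstMoved (j : ℕ) (j<m : j < m) (moved : strand j ≢ j) (fixed : ∀ t → t < j → strand t ≡ t) where
        j<n : j < n
        j<n = ≤-trans j<m (≤-trans (n≤1+n m) (n≤1+n (suc m)))

        j<strand-j : j < strand j
        j<strand-j = ≤∧≢⇒< (strand-≥ j<m) (λ e → moved (sym e))

        j-unreached : ∀ t → t < m → strand t ≢ j
        j-unreached t p with <-cmp t j
        ... | tri< c _ _ = λ e → <⇒≢ c (trans (sym (fixed t c)) e)
        ... | tri≈ _ refl _ = moved
        ... | tri> _ _ c = λ e → <⇒≢ (<-trans j<strand-j (increasing-< strand-increasing c p)) (sym e)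

        open LowerBlock j j<n (unreached-goes-across j<n j-unreached)

        j<w : j < w
        j<w with <-cmp w j
        ... | tri< c _ _ = ⊥-elim (<⇒≱ (subst (_< n) (trans (sym (δ-strand (<-trans c j<m))) (trans (cong (λ z → δ (n + z)) (fixed w c)) δ-w))
                                         (openGap<n (<-trans c j<m))) (m≤m+n n j))
        ... | tri≈ _ e _ = ⊥-elim (w≢k e)
        ... | tri> _ _ c = c

        -- strand j cannot be j + 1: that lower vertex is w or lies inside the cap {j', w'}
        strand-j≢j+1 : strand j ≢ suc j
        strand-j≢j+1 e with <-cmp (suc j) w
        ... | tri≈ _ e' _ = <⇒≱ (subst (_< n) (trans (sym (δ-strand j<m)) (trans (cong (λ z → δ (n + z)) (trans e e')) δ-w)) (openGap<n j<m))
                                 (m≤m+n n j)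
        ... | tri> _ _ c = <⇒≱ c j<w
        ... | tri< c _ _ = δ-planar (openGap i j) (n + w) (upper<2n (openGap<n j<m)) (lower<2n w<n)
               ( subst (_< bpos (n + w)) (sym (bpos-upper (openGap<n j<m))) (<-≤-trans (openGap<n j<m) (n≤bpos-lower w w<n))
               , subst (bpos (n + w) <_) (cong bpos (sym (trans (δ-openGap j<m) (cong (n +_) e)))) (bpos-lower-anti c w<n)
               , subst₂ _<_ (cong bpos (sym (trans (δ-openGap j<m) (cong (n +_) e)))) (cong bpos (sym δ-w))
                   (bpos-lower-anti (n<1+n j) (<-trans c w<n)))

        strand-j : strand j ≡ suc (suc j)
        strand-j with m≤n⇒m<n∨m≡n (strand-≤ j<m)
        ... | inj₂ e = e
        ... | inj₁ c with m≤n⇒m<n∨m≡n (≤-pred c)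
        ...   | inj₂ e = ⊥-elim (strand-j≢j+1 e)
        ...   | inj₁ c' = ⊥-elim (<⇒≱ j<strand-j (≤-pred c'))

        strand-openGap : ∀ t → t < m → strand t ≡ openGap j t
        strand-openGap t p with <-cmp t j
        ... | tri< c _ _ = trans (fixed t c) (sym (openGap-below c))
        ... | tri≈ _ refl _ = trans strand-j (sym (openGap-above ≤-refl))
        ... | tri> _ _ c = trans (≤-antisym (strand-≤ p) beyond) (sym (openGap-above (<⇒≤ c)))
          where
            et : j + (t ∸ j) ≡ t
            et = m+[n∸m]≡n (<⇒≤ c)
            beyond : suc (suc t) ≤ strand t
            beyond = subst₂ _≤_ (trans (cong (_+ (t ∸ j)) strand-j) (cong (λ z → suc (suc z)) et)) (cong strand et)
                       (increasing-+ strand-increasing j (t ∸ j) (subst (_< m) (sym et) p))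

      find-cap : Σ ℕ λ j → (j ≤ m) × (∀ t → t < m → strand t ≡ openGap j t)
      find-cap with first-nonfixed strand m
      ... | inj₁ fixed = m , ≤-refl , (λ t p → trans (fixed t p) (sym (openGap-below p)))
      ... | inj₂ (j , j<m , moved , fixed) = j , <⇒≤ j<m , FirstMoved.strand-openGap j j<m moved fixed

      module WithCap (j : ℕ) (j≤m : j ≤ m) (strand-openGap : ∀ t → t < m → strand t ≡ openGap j t) where
        open StandardFacts i j i≤m j≤m hiding (i<n)

        δ-loThrough : ∀ w → w < n → OffGap j w → δ (n + w) ≡ openGap i (closeGap j w)
        δ-loThrough w q off =
          trans (cong (λ z → δ (n + z)) (sym (trans (strand-openGap (closeGap j w) t<m) (openGap∘closeGap j w off)))) (δ-strand t<m)
          where t<m = closeGap-bound j m w q off j≤m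

        -- the lower vertex j is reached by no strand, so it is capped, with j + 1
        j-across : n ≤ δ (n + j)
        j-across = unreached-goes-across j<n (λ t t<m e → proj₁ (openGap-offGap j t) (trans (sym (strand-openGap t t<m)) e))

        open LowerBlock j j<n j-across

        δ-capL : δ (n + j) ≡ n + suc j
        δ-capL with w ≟ j
        ... | yes e = ⊥-elim (w≢k e)
        ... | no e with w ≟ suc j
        ...   | yes e' = trans δ-k (cong (n +_) e')
        ...   | no e' = ⊥-elim (<⇒≱ (subst (_< n) (trans (sym (δ-loThrough w w<n (e , e'))) δ-w)
                                    (openGap-bound i m _ (closeGap-bound j m w w<n (e , e') j≤m))) (m≤m+n n j))

        δ-standard : ∀ x → x < twoN → δ x ≡ std x
        δ-standard x p with kind x p
        ... | cupL refl = trans δ-cupL (sym std-cupL)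
        ... | cupR refl = trans δ-cupR (sym std-cupR)
        ... | upThrough q off = trans (cong δ (sym (openGap∘closeGap i x off)))
                                 (trans (δ-openGap t<m) (trans (cong (n +_) (strand-openGap _ t<m)) (sym (std-upThrough q off))))
          where t<m = closeGap-bound i m x q off i≤m
        ... | capL refl = trans δ-capL (sym std-capL)
        ... | capR refl = trans (trans (cong δ (sym δ-capL)) (δ-involutive (n + j) (lower<2n j<n))) (sym std-capR)
        ... | loThrough k q off refl = trans (δ-loThrough k q off) (sym (std-loThrough off))

    classify : ∀ a b → a < n → b < n → a ≢ b → δ a < n → UpperPairsAmong a b →
               Σ ℕ λ i → Σ ℕ λ j → (i ≤ m) × (j ≤ m) × (∀ x → x < twoN → δ x ≡ Standard.std i j x)
    classify a b a<n b<n a≢b δa<n among with find-cup a b a<n b<n a≢b δa<n among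
    ... | i , i≤m , δ-cupL , others-down with AfterCup.find-cap i i≤m δ-cupL others-down
    ...   | j , j≤m , strand-openGap = i , j , i≤m , j≤m , AfterCup.WithCap.δ-standard i i≤m δ-cupL others-down j j≤m strand-openGap

  module JonesDiagram (d : Diagram n) (jones : IsJones {n} d) where
    δ : ℕ → ℕ
    δ x = toℕ (partner {n} d (vertex x))

    partner-δ : ∀ a → toℕ (partner {n} d a) ≡ δ (toℕ a)
    partner-δ a = cong (λ z → toℕ (partner {n} d z)) (sym (toFin-toℕ a))

    open Indexed d δ partner-δ
    open JonesIndices δ F<2n (involutive-to-indices (λ a → proj₁ (proj₁ jones a)))
                             (no-fixpoint-to-indices (λ a → proj₂ (proj₁ jones a))) (planar-to-indices (proj₂ jones))

    partner-column : ∀ (u : Fin n) → toℕ (partner {n} d (u ↑ˡ n)) ≡ δ (toℕ u)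
    partner-column u = trans (partner-δ (u ↑ˡ n)) (cong δ (toℕ-↑ˡ u n))

    module TwoCupColumns (a b : Fin n) (cups≡ab : cupColumns d ≡ a ∷ b ∷ []) where
      a≢b : toℕ a ≢ toℕ b
      a≢b e with subst Unique cups≡ab (cupColumns-unique d)
      ... | (a≢b′ ∷ _) ∷ _ = a≢b′ (toℕ-injective e)

      δa<n : δ (toℕ a) < n
      δa<n = subst (_< n) (partner-column a) (≰⇒> (cupColumns-∈ d (subst (a ∈_) (sym cups≡ab) (here refl))))

      among : UpperPairsAmong (toℕ a) (toℕ b)
      among x p q with subst (column x ∈_) cups≡ab (∈-cupColumns d
                         (λ low → <⇒≱ q (subst (n ≤_) (trans (partner-column (column x)) (cong δ (toℕ-toFin x p))) low)))
      ... | here e = inj₁ (trans (sym (toℕ-toFin x p)) (cong toℕ e))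
      ... | there (here e) = inj₂ (trans (sym (toℕ-toFin x p)) (cong toℕ e))

    rank-m⇒standard : rank {n} d ≡ m → Σ ℕ λ i → Σ ℕ λ j → (i ≤ m) × (j ≤ m) × (d ≡ standard i j)
    rank-m⇒standard rk with length≡2 (cupColumns d) (rank≡m⇒two-cupColumns d rk)
    ... | a , b , cups≡ab with classify (toℕ a) (toℕ b) (toℕ<n a) (toℕ<n b) a≢b δa<n among
      where open TwoCupColumns a b cups≡ab
    ...   | i , j , i≤m , j≤m , agree = i , j , i≤m , j≤m , trans determined (fromIndices-cong agree)

  -- the pairs with |i - j| ≤ 1: D(i,j) is idempotent exactly for these
  data Admissible : ℕ → ℕ → Set where
    diagonal : ∀ {i} → i ≤ m → Admissible i i
    above : ∀ {i} → suc i ≤ m → Admissible i (suc i)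
    below : ∀ {j} → suc j ≤ m → Admissible (suc j) j

  admissible-bounds : ∀ {i j} → Admissible i j → (i ≤ m) × (j ≤ m)
  admissible-bounds (diagonal i≤m) = i≤m , i≤m
  admissible-bounds (above i+1≤m) = ≤-trans (n≤1+n _) i+1≤m , i+1≤m
  admissible-bounds (below j+1≤m) = j+1≤m , ≤-trans (n≤1+n _) j+1≤m

  admissible⇒idempotent : ∀ {i j} → Admissible i j → IsIdempotent {n} (standard i j)
  admissible⇒idempotent (diagonal i≤m) = idempotent-diagonal _ i≤m
  admissible⇒idempotent (above i+1≤m) = idempotent-above _ i+1≤m
  admissible⇒idempotent (below j+1≤m) = idempotent-below _ j+1≤m

  module FarApart (i j : ℕ) (i≤m : i ≤ m) (j≤m : j ≤ m) where
    open StandardDiagram i j i≤m j≤m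

    vertexCode-outer-vertex : ∀ x → x < twoN → vertexCode (outer {n} (vertex x)) ≡ outerCode x
    vertexCode-outer-vertex x p = trans (vertexCode-outer (vertex x)) (cong outerCode (toℕ-toFin x p))

    separated : ∀ x y → x < twoN → y < twoN → x ≢ y → std x ≢ y →
                Connected {n} D D (outer {n} (vertex x)) (outer {n} (vertex y)) → ¬ IsIdempotent {n} D
    separated x y px py x≢y δx≢y conn idem with Equivalence.to (idem (vertex x) (vertex y)) conn
    ... | inj₁ e = x≢y (trans (sym (toℕ-toFin x px)) (trans (cong toℕ e) (toℕ-toFin y py)))
    ... | inj₂ e = δx≢y (trans (sym (partner-vertex x px)) (trans (cong toℕ e) (toℕ-toFin y py)))

    -- if i + 1 < j, the top vertices i+2 and i+3 are joined through the middle cup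
    cap-far-right : suc i < j → ¬ IsIdempotent {n} D
    cap-far-right i+1<j = separated x₀ x₁ (upper<2n x₀<n) (upper<2n x₁<n) (<⇒≢ (n<1+n x₀))
      (λ e → <⇒≱ x₁<n (subst (n ≤_) (trans (sym std-x₀) e) (m≤m+n n i))) path
      where
        x₀ = suc (suc i)
        x₁ = suc (suc (suc i))
        x₁<n : x₁ < n
        x₁<n = ≤-trans (s≤s (s≤s i+1<j)) j+1<n
        x₀<n : x₀ < n
        x₀<n = <-trans (n<1+n x₀) x₁<n
        i<j : i < j
        i<j = <-trans (n<1+n i) i+1<j
        std-x₀ : std x₀ ≡ n + i
        std-x₀ = trans (std-upThrough x₀<n ((λ e → <⇒≢ (≤-trans (n<1+n i) (n≤1+n _)) (sym e)) , (λ e → <⇒≢ (n<1+n (suc i)) (sym e))))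
                       (cong (n +_) (trans (cong (openGap j) (closeGap-above (≤-trans (n≤1+n i) (n≤1+n _)))) (openGap-below i<j)))
        std-i+1 : std (n + suc i) ≡ x₁
        std-i+1 = trans (std-loThrough ((λ e → <⇒≢ i+1<j e) , (λ e → <⇒≢ (<-trans i+1<j (n<1+n j)) e)))
                        (trans (cong (openGap i) (closeGap-below i+1<j)) (openGap-above (n≤1+n i)))
        path : Connected {n} D D (outer {n} (vertex x₀)) (outer {n} (vertex x₁))
        path = upperEdge x₀ (upper<2n x₀<n) (trans (vertexCode-outer-vertex x₀ (upper<2n x₀<n)) (outerCode-upper x₀<n))
                 (trans (vertexCode-middle i<n) (sym std-x₀))
             ◅ lowerEdge i (upper<2n i<n) {middle i} {middle (suc i)} (vertexCode-middle i<n) (trans (vertexCode-middle i+1<n) (cong (n +_) (sym std-cupL)))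
             ◅ upperEdge (n + suc i) (lower<2n i+1<n) (vertexCode-middle i+1<n)
                 (trans (vertexCode-outer-vertex x₁ (upper<2n x₁<n)) (trans (outerCode-upper x₁<n) (sym std-i+1)))
             ◅ ε

    -- if j + 1 < i, the bottom vertices (j+2)' and (j+3)' are joined through the middle cap
    cap-far-left : suc j < i → ¬ IsIdempotent {n} D
    cap-far-left j+1<i = separated y₀ y₁ (lower<2n k₀<n) (lower<2n k₁<n) (λ e → <⇒≢ (n<1+n k₀) (+-cancelˡ-≡ n _ _ e))
      (λ e → <⇒≱ j<n (subst (n ≤_) (sym (trans (sym std-y₀) e)) (m≤m+n n k₁))) path
      where
        k₀ = suc (suc j)
        k₁ = suc (suc (suc j))
        k₁<n : k₁ < n
        k₁<n = ≤-trans (s≤s (s≤s j+1<i)) i+1<n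
        k₀<n : k₀ < n
        k₀<n = <-trans (n<1+n k₀) k₁<n
        y₀ = n + k₀
        y₁ = n + k₁
        j<i : j < i
        j<i = <-trans (n<1+n j) j+1<i
        std-y₀ : std y₀ ≡ j
        std-y₀ = trans (std-loThrough ((λ e → <⇒≢ (≤-trans (n<1+n j) (n≤1+n _)) (sym e)) , (λ e → <⇒≢ (n<1+n (suc j)) (sym e))))
                       (trans (cong (openGap i) (closeGap-above (≤-trans (n≤1+n j) (n≤1+n _)))) (openGap-below j<i))
        std-j+1 : std (suc j) ≡ y₁
        std-j+1 = trans (std-upThrough j+1<n ((λ e → <⇒≢ j+1<i e) , (λ e → <⇒≢ (<-trans j+1<i (n<1+n i)) e)))
                        (cong (n +_) (trans (cong (openGap j) (closeGap-below j+1<i)) (openGap-above (n≤1+n j))))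
        path : Connected {n} D D (outer {n} (vertex y₀)) (outer {n} (vertex y₁))
        path = lowerEdge y₀ (lower<2n k₀<n) (trans (vertexCode-outer-vertex y₀ (lower<2n k₀<n)) (outerCode-lower k₀))
                 (trans (vertexCode-middle j<n) (cong (n +_) (sym std-y₀)))
             ◅ upperEdge (n + j) (lower<2n j<n) {middle j} {middle (suc j)} (vertexCode-middle j<n) (trans (vertexCode-middle j+1<n) (sym std-capL))
             ◅ lowerEdge (suc j) (upper<2n j+1<n) (vertexCode-middle j+1<n)
                 (trans (vertexCode-outer-vertex y₁ (lower<2n k₁<n)) (trans (outerCode-lower k₁) (cong (n +_) (sym std-j+1))))
             ◅ ε

  idempotent⇒admissible : ∀ i j → i ≤ m → j ≤ m → IsIdempotent {n} (standard i j) → Admissible i j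
  idempotent⇒admissible i j i≤m j≤m idem with <-cmp i j
  ... | tri≈ _ refl _ = diagonal i≤m
  ... | tri< i<j _ _ with <-cmp (suc i) j
  ...   | tri≈ _ refl _ = above j≤m
  ...   | tri< i+1<j _ _ = ⊥-elim (FarApart.cap-far-right i j i≤m j≤m i+1<j idem)
  ...   | tri> _ _ c = ⊥-elim (<⇒≱ c i<j)
  idempotent⇒admissible i j i≤m j≤m idem | tri> _ _ j<i with <-cmp (suc j) i
  ...   | tri≈ _ refl _ = below i≤m
  ...   | tri< j+1<i _ _ = ⊥-elim (FarApart.cap-far-left i j i≤m j≤m j+1<i idem)
  ...   | tri> _ _ c = ⊥-elim (<⇒≱ c j<i)

  AdmissibleStandard : Diagram n → Set
  AdmissibleStandard d = Σ ℕ λ i → Σ ℕ λ j → Admissible i j × (d ≡ standard i j)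

  idempotent-of-rank-m⇒admissible : ∀ d → IsIdempotentOfRank n m d → AdmissibleStandard d
  idempotent-of-rank-m⇒admissible d (jones , idem , rk) = admissible (JonesDiagram.rank-m⇒standard d jones rk)
    where
      admissible : (Σ ℕ λ i → Σ ℕ λ j → (i ≤ m) × (j ≤ m) × (d ≡ standard i j)) → AdmissibleStandard d
      admissible (i , j , i≤m , j≤m , d≡D) = i , j , idempotent⇒admissible i j i≤m j≤m (subst (IsIdempotent {n}) d≡D idem) , d≡D

  admissible⇒idempotent-of-rank-m : ∀ {i j} → Admissible i j → IsIdempotentOfRank n m (standard i j)
  admissible⇒idempotent-of-rank-m {i} {j} adm =
    StandardDiagram.standard-Jones i j i≤m j≤m , admissible⇒idempotent adm , StandardDiagram.standard-rank i j i≤m j≤m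
    where
      i≤m = proj₁ (admissible-bounds adm)
      j≤m = proj₂ (admissible-bounds adm)
  -- D(i,j) determines (i, j): its cup is at i and its cap at j
  standard-injective : ∀ {i j i' j'} → i ≤ m → j ≤ m → i' ≤ m → j' ≤ m → standard i j ≡ standard i' j' → (i ≡ i') × (j ≡ j')
  standard-injective {i} {j} {i'} {j'} i≤m j≤m i'≤m j'≤m e =
    (D'.cup-position i (s≤s (s≤s i≤m)) (trans (same-partner i (upper<2n D.i<n)) D.std-cupL)) ,
    (D'.cap-position j (s≤s (s≤s j≤m)) (trans (same-partner (n + j) (lower<2n D.j<n)) D.std-capL))
    where
      module D = StandardDiagram i j i≤m j≤m
      module D' = StandardDiagram i' j' i'≤m j'≤m
      same-partner : ∀ x → x < twoN → D'.std x ≡ D.std x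
      same-partner x p = trans (sym (D'.partner-vertex x p)) (trans (cong (λ v → toℕ (partner {n} v (vertex x))) (sym e)) (D.partner-vertex x p))

  diagonals aboves belows idempotents : List (Diagram n)
  diagonals = applyUpTo (λ i → standard i i) (suc m)
  aboves = applyUpTo (λ i → standard i (suc i)) m
  belows = applyUpTo (λ j → standard (suc j) j) m
  idempotents = diagonals ++ aboves ++ belows

  ∈-idempotents⁺ : ∀ {i j} → Admissible i j → standard i j ∈ idempotents
  ∈-idempotents⁺ (diagonal i≤m) = ∈-++⁺ˡ (∈-applyUpTo⁺ (λ i → standard i i) (s≤s i≤m))
  ∈-idempotents⁺ (above i+1≤m) = ∈-++⁺ʳ diagonals (∈-++⁺ˡ (∈-applyUpTo⁺ (λ i → standard i (suc i)) i+1≤m))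
  ∈-idempotents⁺ (below j+1≤m) = ∈-++⁺ʳ diagonals (∈-++⁺ʳ aboves (∈-applyUpTo⁺ (λ j → standard (suc j) j) j+1≤m))

  ∈-idempotents⁻ : ∀ {d} → d ∈ idempotents → AdmissibleStandard d
  ∈-idempotents⁻ d∈ with ∈-++⁻ diagonals d∈
  ... | inj₁ d∈diag with ∈-applyUpTo⁻ (λ i → standard i i) d∈diag
  ...   | i , i<m+1 , d≡D = i , i , diagonal (≤-pred i<m+1) , d≡D
  ∈-idempotents⁻ d∈ | inj₂ d∈rest with ∈-++⁻ aboves d∈rest
  ... | inj₁ d∈above with ∈-applyUpTo⁻ (λ i → standard i (suc i)) d∈above
  ...   | i , i<m , d≡D = i , suc i , above i<m , d≡D
  ∈-idempotents⁻ d∈ | inj₂ d∈rest | inj₂ d∈below with ∈-applyUpTo⁻ (λ j → standard (suc j) j) d∈below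
  ...   | j , j<m , d≡D = suc j , j , below j<m , d≡D

  i≢1+i : ∀ {i} → i ≢ suc i
  i≢1+i e = <⇒≢ (n<1+n _) e

  idempotents-unique : Unique idempotents
  idempotents-unique =
    ++⁺ (applyUpTo⁺₁ (λ i → standard i i) (suc m) (λ i<j j<m+1 e → <⇒≢ i<j (proj₁ (standard-injective (≤-pred (<-trans i<j j<m+1)) (≤-pred (<-trans i<j j<m+1)) (≤-pred j<m+1) (≤-pred j<m+1) e))))
        (++⁺ (applyUpTo⁺₁ (λ i → standard i (suc i)) m (λ i<j j<m e → <⇒≢ i<j (proj₁ (standard-injective (<⇒≤ (<-trans i<j j<m)) (<-trans i<j j<m) (<⇒≤ j<m) j<m e))))
             (applyUpTo⁺₁ (λ j → standard (suc j) j) m (λ i<j j<m e → <⇒≢ i<j (proj₂ (standard-injective (<-trans i<j j<m) (<⇒≤ (<-trans i<j j<m)) j<m (<⇒≤ j<m) e))))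
             above-below)
        diagonal-rest
    where
      above-below : ∀ {d} → ¬ (d ∈ aboves × d ∈ belows)
      above-below (d∈above , d∈below) with ∈-applyUpTo⁻ (λ i → standard i (suc i)) d∈above
                                         | ∈-applyUpTo⁻ (λ j → standard (suc j) j) d∈below
      ... | i , i<m , d≡D | j , j<m , d≡D' with standard-injective (<⇒≤ i<m) i<m j<m (<⇒≤ j<m) (trans (sym d≡D) d≡D')
      ...   | i≡j+1 , i+1≡j = <⇒≢ (≤-trans (n<1+n i) (n≤1+n _)) (trans i≡j+1 (cong suc (sym i+1≡j)))
      diagonal-rest : ∀ {d} → ¬ (d ∈ diagonals × d ∈ aboves ++ belows)
      diagonal-rest (d∈diag , d∈rest) with ∈-applyUpTo⁻ (λ i → standard i i) d∈diag | ∈-++⁻ aboves d∈rest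
      ... | i , i<m+1 , d≡D | inj₁ d∈above with ∈-applyUpTo⁻ (λ k → standard k (suc k)) d∈above
      ...   | k , k<m , d≡D' with standard-injective (≤-pred i<m+1) (≤-pred i<m+1) (<⇒≤ k<m) k<m (trans (sym d≡D) d≡D')
      ...     | i≡k , i≡k+1 = i≢1+i (trans (sym i≡k) i≡k+1)
      diagonal-rest (d∈diag , d∈rest) | i , i<m+1 , d≡D | inj₂ d∈below with ∈-applyUpTo⁻ (λ k → standard (suc k) k) d∈below
      ...   | k , k<m , d≡D' with standard-injective (≤-pred i<m+1) (≤-pred i<m+1) k<m (<⇒≤ k<m) (trans (sym d≡D) d≡D')
      ...     | i≡k+1 , i≡k = i≢1+i (trans (sym i≡k) i≡k+1)
  length-idempotents : length idempotents ≡ 3 * n ∸ 5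
  length-idempotents = begin
    length idempotents                       ≡⟨ length-++ diagonals ⟩
    length diagonals + length (aboves ++ belows) ≡⟨ cong (length diagonals +_) (length-++ aboves) ⟩
    length diagonals + (length aboves + length belows)
                                             ≡⟨ cong₂ _+_ (length-applyUpTo (λ i → standard i i) (suc m))
                                                   (cong₂ _+_ (length-applyUpTo (λ i → standard i (suc i)) m) (length-applyUpTo (λ j → standard (suc j) j) m)) ⟩
    suc m + (m + m)                          ≡⟨ sym (m+n∸m≡n 5 _) ⟩
    5 + (suc m + (m + m)) ∸ 5                ≡⟨ cong (_∸ 5) (sym (three-n m)) ⟩
    3 * n ∸ 5                                ∎
    where
      open ≡-Reasoning
      three-n : ∀ k → 3 * suc (suc k) ≡ 5 + (suc k + (k + k))
      three-n = solve-∀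

proposition6p4 : (n : ℕ) → 2 ≤ n →
    Σ (List (Diagram n)) λ L →
      Unique L × (∀ d → (d ∈ L) ⇔ IsIdempotentOfRank n (n ∸ 2) d) × (length L ≡ 3 * n ∸ 5)
proposition6p4 (suc zero) (s≤s ())
proposition6p4 (suc (suc m)) _ =
  idempotents , idempotents-unique , (λ d → mk⇔ (listed⇒idempotent d ∘ ∈-idempotents⁻) (idempotent⇒listed d ∘ idempotent-of-rank-m⇒admissible d)) ,
  length-idempotents
  where
    open RankMinusTwo m
    listed⇒idempotent : ∀ d → AdmissibleStandard d → IsIdempotentOfRank n m d
    listed⇒idempotent d (i , j , adm , d≡D) = subst (IsIdempotentOfRank n m) (sym d≡D) (admissible⇒idempotent-of-rank-m adm)
    idempotent⇒listed : ∀ d → AdmissibleStandard d → d ∈ idempotents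
    idempotent⇒listed d (i , j , adm , d≡D) = subst (_∈ idempotents) (sym d≡D) (∈-idempotents⁺ adm)
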